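{- Fix an integer $H\geq 3$ and $q\in\mathbb{Q}\cap\mathbb{Z}_{2}$. Then the sequence $\left\{ L_{H}\left(R_{n}\left(\Phi\left(L_{n}(q)\right)\right)\right)\right\}_{n\in\mathbb{N}}$ is eventually periodic.
   Context: $\mathbb{Z}_2$ is the ring of $2$-adic integers; $\mathbb{N}=\{0,1,2,\dots\}$. Every $x\in\mathbb{Z}_2$ has a unique expansion $x=\sum_{i\geq0}d_i2^i$ with $d_i\in\{0,1\}$, written $x=d_0d_1d_2\cdots$. The map $\Phi:\mathbb{Z}_2\to\mathbb{Z}_2$ is defined as follows: if $x=\sum_i 2^{e_i}$ with $0\leq e_0<e_1<\cdots$ (finite or infinite sum; $x=0$ corresponds to the empty sum), then $\Phi(x)=-\sum_i 2^{e_i}3^{ -i}$ (a $2$-adically convergent sum; $\Phi(0)=0$). The shift $\sigma:\mathbb{Z}_2\to\mathbb{Z}_2$ is $\sigma(d_0d_1d_2\cdots)=d_1d_2\cdots$. For $x\in\mathbb{Z}_2$ and $k\in\mathbb{N}$, $L_k(x)$ denotes the least natural number congruent to $x$ modulo $2^k$ (i.e. $d_0+d_12+\cdots+d_{k-1}2^{k-1}$), and $R_k(x)=\sigma^k(x)=d_kd_{k+1}\cdots$. -}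

module Defs where

open import Data.Bool using (Bool; true; false; if_then_else_)
open import Data.Nat using (ℕ; zero; suc; _+_; _*_; _^_; _/_; _%_; _≤_; _<_; _>_; _≡ᵇ_)
open import Data.Integer as ℤ using (ℤ; +_; ∣_∣; _-_)
open import Data.Integer.DivMod using (_/ℕ_)
open import Data.Rational as ℚ using (ℚ; ↥_; ↧ₙ_; 0ℚ; 1ℚ)
open import Data.List using (List; []; _∷_; upTo; filter)
open import Data.Nat using (>-nonZero)
open import Data.Nat.Properties using (m^n>0)
open import Data.Bool using () renaming (_≟_ to _≟ᴮ_)
open import Data.Product using (Σ; ∃; _×_)
open import Relation.Binary.PropositionalEquality using (_≡_)
open import Relation.Nullary.Decidable using (⌊_⌋)

-- A 2-adic integer, represented by its digit sequence d₀ d₁ d₂ ⋯ (x = Σ dᵢ 2ⁱ).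
ℤ₂ : Set
ℤ₂ = ℕ → Bool

bitVal : Bool → ℕ
bitVal true  = 1
bitVal false = 0

L : ℕ → ℤ₂ → ℕ
L zero    x = 0
L (suc k) x = L k x + bitVal (x k) * 2 ^ k

σ : ℤ₂ → ℤ₂
σ x i = x (suc i)

R : ℕ → ℤ₂ → ℤ₂
R zero    x = x
R (suc k) x = R k (σ x)

natDigits : ℕ → ℤ₂
natDigits m i = (m / 2 ^ i) % 2 ≡ᵇ 1
  where instance _ = >-nonZero (m^n>0 2 i)

-- 2-adic digits of the rational a / b, for b odd (the only case used):
-- d₀ = a mod 2, and the tail is the expansion of (a/b - d₀)/2 = ((a - d₀ b)/2)/b.
ratDigits : ℤ → ℕ → ℤ₂
ratDigits a b zero    = ∣ a ∣ % 2 ≡ᵇ 1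
ratDigits a b (suc i) =
  ratDigits ((a - (if ∣ a ∣ % 2 ≡ᵇ 1 then + b else + 0)) /ℕ 2) b i

-- The embedding ℚ ∩ ℤ₂ → ℤ₂ (meaningful when the denominator is odd).
ℚtoℤ₂ : ℚ → ℤ₂
ℚtoℤ₂ q = ratDigits (↥ q) (↧ₙ q)

-- q ∈ ℚ ∩ ℤ₂  ⇔  the reduced denominator of q is odd
InZ₂ : ℚ → Set
InZ₂ q = ↧ₙ q % 2 ≡ 1

-- exponents e₀ < e₁ < ⋯ of the binary expansion m = Σ 2^{e_i}
-- (every exponent is < m since 2^m > m)
exponents : ℕ → List ℕ
exponents m = filter (λ i → _≟ᴮ_ (natDigits m i) true) (upTo m)

third : ℚ
third = + 1 ℚ./ 3

powℚ : ℚ → ℕ → ℚ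
powℚ x zero    = 1ℚ
powℚ x (suc n) = x ℚ.* powℚ x n

Φsum : ℕ → List ℕ → ℚ
Φsum j []       = 0ℚ
Φsum j (e ∷ es) = ((+ (2 ^ e)) ℚ./ 1) ℚ.* powℚ third j ℚ.+ Φsum (suc j) es

-- Φ on natural numbers: Φ(Σ_i 2^{e_i}) = - Σ_i 2^{e_i} 3^{-i}  (a rational with odd denominator)
Φ : ℕ → ℚ
Φ m = ℚ.- Φsum 0 (exponents m)

EventuallyPeriodic : (ℕ → ℕ) → Set
EventuallyPeriodic s = Σ ℕ λ N → Σ ℕ λ p → (p > 0) × ((n : ℕ) → N ≤ n → s (n + p) ≡ s n)

-- The digits d of q are eventually periodic, because the numerators produced by
-- 2-adic long division by the odd denominator of q stay bounded. Truncating d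
-- after n digits gives Φ (L n d) = - P n / 3 ^ k n, where k n counts the ones
-- among the first n digits. If d has period p from N₀ on, with c ones per
-- period, then for n ≥ N₀ this fraction splits as Z + 2 ^ n · Q n / (3 ^ k n · D)
-- with D = 3 ^ c - 2 ^ p odd, Z = Φ (d) independent of n, and Q n depending only
-- on n modulo p. So modulo 2 ^ H the window L H (R n ·) is the sum of H digits of
-- Z starting at position n, which are eventually periodic in n, and the lowest H
-- digits of Q n / (3 ^ k n · D), which are periodic in n since 3 ^ 2 ^ H ≡ 1
-- modulo 2 ^ H. All 2-adic arguments are congruences: a digit sequence x is the
-- expansion of a / b (b odd) when b · L M x ≡ a modulo 2 ^ M for every M.

module Submission where

open import Defs
open import Data.Bool using (Bool; true; false; if_then_else_)
open import Data.Nat as ℕ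
  using (ℕ; zero; suc; _+_; _*_; _∸_; _^_; _≤_; _<_; _≡ᵇ_; _%_; _/_; z≤n; s≤s; NonZero)
import Data.Nat.Properties as ℕ
open import Data.Nat.Tactic.RingSolver using (solve-∀)
open import Data.Integer as ℤ using (ℤ; +_; -[1+_]; ∣_∣; 0ℤ; 1ℤ)
import Data.Integer.Properties as ℤ
import Data.Integer.Tactic.RingSolver as ℤ
open import Data.Integer.Divisibility.Signed as ℤ∣ using (_∣_; divides)
open import Data.Product using (Σ; ∃; ∃₂; _×_; _,_)
open import Data.Nat.GeneralisedArithmetic using (iterate)
open import Data.Fin as Fin using (Fin; toℕ; fromℕ<)
import Data.Fin.Properties as Fin
open import Data.Empty using (⊥-elim)
open import Data.Rational as ℚ using (ℚ; mkℚ; ↥_; ↧_; ↧ₙ_; 0ℚ; 1ℚ; toℚᵘ)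
import Data.Rational.Properties as ℚ
open import Data.Rational.Unnormalised as ℚᵘ using (mkℚᵘ; *≡*)
import Data.Rational.Unnormalised.Properties as ℚᵘ
open import Data.Rational.Solver using (module +-*-Solver)
import Data.Nat.Coprimality as Coprime
open import Data.Nat.DivMod
  using (+-distrib-/-∣ʳ; m<n⇒m/n≡0; m*n/n≡m; [m+kn]%n≡m%n; m<n⇒m%n≡m; m%n<n; m≡m%n+[m/n]*n)
open import Data.Integer.DivMod using (_/ℕ_; _%ℕ_; n%ℕd<d; a≡a%ℕn+[a/ℕn]*n)
open import Data.Nat.Divisibility as ℕ∣ using (m∣m*n; n∣m⇒m%n≡0)
open import Data.List using (List; []; _∷_; [_]; _++_; upTo; filter; length)
import Data.List.Properties as List
open import Data.Bool using () renaming (_≟_ to _≟ᴮ_)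
open import Relation.Binary.PropositionalEquality hiding ([_])
open import Relation.Binary.Bundles using (Setoid)
open import Relation.Binary.Structures using (IsEquivalence)
import Relation.Binary.Reasoning.Setoid as SetoidReasoning

-- Digits and truncations

R-apply : ∀ n x i → R n x i ≡ x (n + i)
R-apply zero    x i = refl
R-apply (suc n) x i = R-apply n (σ x) i

R-+ : ∀ m n x → R (m + n) x ≡ R n (R m x)
R-+ zero    n x = refl
R-+ (suc m) n x = R-+ m n (σ x)

head-R : ∀ n x → R n x 0 ≡ x n
head-R n x = trans (R-apply n x 0) (cong x (ℕ.+-identityʳ n))

σ-R : ∀ n x i → σ (R n x) i ≡ R (suc n) x i
σ-R n x i = begin
  R n x (suc i)        ≡⟨ R-apply n x (suc i) ⟩
  x (n + suc i)        ≡⟨ cong x (ℕ.+-suc n i) ⟩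
  x (suc n + i)        ≡⟨ R-apply (suc n) x i ⟨
  R (suc n) x i        ∎
  where open ≡-Reasoning

L-cong : ∀ m {x y} → (∀ i → i < m → x i ≡ y i) → L m x ≡ L m y
L-cong zero    x≈y = refl
L-cong (suc m) x≈y =
  cong₂ (λ a b → a + bitVal b * 2 ^ m) (L-cong m λ i i<m → x≈y i (ℕ.m<n⇒m<1+n i<m)) (x≈y m ℕ.≤-refl)

L-head : ∀ m x → L (suc m) x ≡ bitVal (x 0) + 2 * L m (σ x)
L-head zero    x = trans (ℕ.*-identityʳ _) (sym (ℕ.+-identityʳ _))
L-head (suc m) x = begin
  L (suc m) x + bitVal (x (suc m)) * 2 ^ suc m                    ≡⟨ cong (_+ bitVal (x (suc m)) * 2 ^ suc m) (L-head m x) ⟩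
  bitVal (x 0) + 2 * L m (σ x) + bitVal (x (suc m)) * (2 * 2 ^ m)  ≡⟨ regroup (bitVal (x 0)) (L m (σ x)) (bitVal (x (suc m))) (2 ^ m) ⟩
  bitVal (x 0) + 2 * (L m (σ x) + bitVal (x (suc m)) * 2 ^ m)      ∎
  where
  open ≡-Reasoning
  regroup : ∀ a l b p → a + 2 * l + b * (2 * p) ≡ a + 2 * (l + b * p)
  regroup = solve-∀

L-+ : ∀ m n x → L (m + n) x ≡ L m x + 2 ^ m * L n (R m x)
L-+ zero    n x = sym (ℕ.*-identityˡ _)
L-+ (suc m) n x = begin
  L (suc (m + n)) x                                      ≡⟨ L-head (m + n) x ⟩
  b + 2 * L (m + n) (σ x)                                ≡⟨ cong (λ l → b + 2 * l) (L-+ m n (σ x)) ⟩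
  b + 2 * (L m (σ x) + 2 ^ m * L n (R m (σ x)))          ≡⟨ regroup b (L m (σ x)) (2 ^ m) (L n (R m (σ x))) ⟩
  (b + 2 * L m (σ x)) + 2 * 2 ^ m * L n (R m (σ x))      ≡⟨ cong (_+ 2 ^ suc m * L n (R (suc m) x)) (L-head m x) ⟨
  L (suc m) x + 2 ^ suc m * L n (R (suc m) x)            ∎
  where
  open ≡-Reasoning
  b = bitVal (x 0)
  regroup : ∀ b l p t → b + 2 * (l + p * t) ≡ (b + 2 * l) + 2 * p * t
  regroup = solve-∀

bitVal≤1 : ∀ b → bitVal b ≤ 1
bitVal≤1 true  = ℕ.≤-refl
bitVal≤1 false = z≤n

L<2^ : ∀ m x → L m x < 2 ^ m
L<2^ zero    x = s≤s z≤n
L<2^ (suc m) x = begin-strict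
  L m x + bitVal (x m) * 2 ^ m  <⟨ ℕ.+-monoˡ-< _ (L<2^ m x) ⟩
  2 ^ m + bitVal (x m) * 2 ^ m  ≤⟨ ℕ.+-monoʳ-≤ (2 ^ m) (ℕ.*-monoˡ-≤ (2 ^ m) (bitVal≤1 (x m))) ⟩
  2 ^ m + 1 * 2 ^ m             ≡⟨ solve-∀ ⟩
  2 ^ suc m                     ∎
  where open ℕ.≤-Reasoning

L/2^ : ∀ i n x → (L (i + n) x / 2 ^ i) {{ℕ.m^n≢0 2 i}} ≡ L n (R i x)
L/2^ i n x = begin
  L (i + n) x / 2 ^ i                                 ≡⟨ cong (_/ 2 ^ i) (L-+ i n x) ⟩
  (L i x + 2 ^ i * L n (R i x)) / 2 ^ i               ≡⟨ +-distrib-/-∣ʳ (L i x) (m∣m*n (L n (R i x))) ⟩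
  L i x / 2 ^ i + 2 ^ i * L n (R i x) / 2 ^ i         ≡⟨ cong₂ _+_ (m<n⇒m/n≡0 (L<2^ i x)) high ⟩
  L n (R i x)                                         ∎
  where
  open ≡-Reasoning
  instance _ = ℕ.m^n≢0 2 i
  high : 2 ^ i * L n (R i x) / 2 ^ i ≡ L n (R i x)
  high = trans (cong (_/ 2 ^ i) (ℕ.*-comm (2 ^ i) _)) (m*n/n≡m _ (2 ^ i))

L%2 : ∀ m x → L (suc m) x % 2 ≡ bitVal (x 0)
L%2 m x = begin
  L (suc m) x % 2                   ≡⟨ cong (_% 2) (L-head m x) ⟩
  (bitVal (x 0) + 2 * L m (σ x)) % 2 ≡⟨ cong (λ k → (bitVal (x 0) + k) % 2) (ℕ.*-comm 2 (L m (σ x))) ⟩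
  (bitVal (x 0) + L m (σ x) * 2) % 2 ≡⟨ [m+kn]%n≡m%n (bitVal (x 0)) (L m (σ x)) 2 ⟩
  bitVal (x 0) % 2                   ≡⟨ m<n⇒m%n≡m (s≤s (bitVal≤1 (x 0))) ⟩
  bitVal (x 0)                       ∎
  where open ≡-Reasoning

bitVal≡ᵇ1 : ∀ b → (bitVal b ≡ᵇ 1) ≡ b
bitVal≡ᵇ1 true  = refl
bitVal≡ᵇ1 false = refl

m<2^m : ∀ m → m < 2 ^ m
m<2^m zero    = s≤s z≤n
m<2^m (suc m) = ℕ.≤-<-trans (m<2^m m) (ℕ.m<m+n (2 ^ m) (ℕ.m≤n⇒m≤n+o 0 (ℕ.m^n>0 2 m)))

natDigits-<2^ : ∀ {m} i → m < 2 ^ i → natDigits m i ≡ false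
natDigits-<2^ i m<2^i = cong (λ k → k % 2 ≡ᵇ 1) (m<n⇒m/n≡0 {{ℕ.m^n≢0 2 i}} m<2^i)

natDigits-L : ∀ {n} x {i} → i < n → natDigits (L n x) i ≡ x i
natDigits-L x {i} i<n with ℕ.m≤n⇒∃[o]m+o≡n i<n
... | j , refl = begin
  natDigits (L (suc i + j) x) i          ≡⟨ cong (λ k → natDigits (L k x) i) (sym (ℕ.+-suc i j)) ⟩
  L (i + suc j) x / 2 ^ i % 2 ≡ᵇ 1       ≡⟨ cong (λ m → m % 2 ≡ᵇ 1) (L/2^ i (suc j) x) ⟩
  L (suc j) (R i x) % 2 ≡ᵇ 1             ≡⟨ cong (_≡ᵇ 1) (L%2 j (R i x)) ⟩
  bitVal (R i x 0) ≡ᵇ 1                  ≡⟨ bitVal≡ᵇ1 (R i x 0) ⟩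
  R i x 0                                ≡⟨ R-apply i x 0 ⟩
  x (i + 0)                              ≡⟨ cong x (ℕ.+-identityʳ i) ⟩
  x i                                    ∎
  where
  open ≡-Reasoning
  instance _ = ℕ.m^n≢0 2 i

positions : ℤ₂ → ℕ → List ℕ
positions x zero    = []
positions x (suc n) = positions x n ++ (if x n then [ n ] else [])

filter-upTo : ∀ t n → filter (λ i → t i ≟ᴮ true) (upTo n) ≡ positions t n
filter-upTo t zero    = refl
filter-upTo t (suc n) = begin
  filter t? (upTo (suc n))                ≡⟨ cong (filter t?) (List.upTo-∷ʳ n) ⟨
  filter t? (upTo n ++ [ n ])             ≡⟨ List.filter-++ t? (upTo n) [ n ] ⟩
  filter t? (upTo n) ++ filter t? [ n ]   ≡⟨ cong₂ _++_ (filter-upTo t n) (last (t n) refl) ⟩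
  positions t (suc n)                     ∎
  where
  open ≡-Reasoning
  t? = λ i → t i ≟ᴮ true
  last : ∀ b → t n ≡ b → filter t? [ n ] ≡ (if b then [ n ] else [])
  last true  tn≡b rewrite tn≡b = refl
  last false tn≡b rewrite tn≡b = refl

positions-cong : ∀ n {t u} → (∀ i → i < n → t i ≡ u i) → positions t n ≡ positions u n
positions-cong zero    t≈u = refl
positions-cong (suc n) t≈u =
  cong₂ (λ ps b → ps ++ (if b then [ n ] else []))
        (positions-cong n λ i i<n → t≈u i (ℕ.m<n⇒m<1+n i<n)) (t≈u n ℕ.≤-refl)

positions-+ : ∀ n j {t} → (∀ i → n ≤ i → t i ≡ false) → positions t (n + j) ≡ positions t n
positions-+ n zero    t≡false = cong (positions _) (ℕ.+-identityʳ n)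
positions-+ n (suc j) {t} t≡false rewrite ℕ.+-suc n j | t≡false (n + j) (ℕ.m≤m+n n j) =
  trans (List.++-identityʳ _) (positions-+ n j t≡false)

exponents-L : ∀ n x → exponents (L n x) ≡ positions x n
exponents-L n x = begin
  exponents m              ≡⟨ filter-upTo y m ⟩
  positions y m            ≡⟨ positions-+ m n (λ i m≤i → natDigits-<2^ i (ℕ.<-≤-trans (m<2^m m) (ℕ.^-monoʳ-≤ 2 m≤i))) ⟨
  positions y (m + n)      ≡⟨ cong (positions y) (ℕ.+-comm m n) ⟩
  positions y (n + m)      ≡⟨ positions-+ n m (λ i n≤i → natDigits-<2^ i (ℕ.<-≤-trans (L<2^ n x) (ℕ.^-monoʳ-≤ 2 n≤i))) ⟩
  positions y n            ≡⟨ positions-cong n (λ i → natDigits-L x) ⟩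
  positions x n            ∎
  where
  open ≡-Reasoning
  m = L n x
  y = natDigits m

-- Congruence modulo powers of two

infix 4 _≡_[mod2^_]

record _≡_[mod2^_] (a b : ℤ) (K : ℕ) : Set where
  constructor mod2^
  field 2^K∣a-b : + (2 ^ K) ∣ a ℤ.- b

*-distribˡ-- : ∀ c a b → c ℤ.* (a ℤ.- b) ≡ c ℤ.* a ℤ.- c ℤ.* b
*-distribˡ-- = ℤ.solve-∀

module _ {K : ℕ} where

  mod-reflexive : ∀ {a b} → a ≡ b → a ≡ b [mod2^ K ]
  mod-reflexive {a} refl = mod2^ (divides 0ℤ (ℤ.+-inverseʳ a))

  mod-sym : ∀ {a b} → a ≡ b [mod2^ K ] → b ≡ a [mod2^ K ]
  mod-sym {a} {b} (mod2^ a≡b) = mod2^ (subst (_ ∣_) (flip a b) (ℤ∣.∣m⇒∣-m a≡b))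
    where
    flip : ∀ a b → ℤ.- (a ℤ.- b) ≡ b ℤ.- a
    flip = ℤ.solve-∀

  mod-trans : ∀ {a b c} → a ≡ b [mod2^ K ] → b ≡ c [mod2^ K ] → a ≡ c [mod2^ K ]
  mod-trans {a} {b} {c} (mod2^ a≡b) (mod2^ b≡c) =
    mod2^ (subst (_ ∣_) (telescope a b c) (ℤ∣.∣m∣n⇒∣m+n a≡b b≡c))
    where
    telescope : ∀ a b c → (a ℤ.- b) ℤ.+ (b ℤ.- c) ≡ a ℤ.- c
    telescope = ℤ.solve-∀

  mod-isEquivalence : IsEquivalence (_≡_[mod2^ K ])
  mod-isEquivalence = record
    { refl = mod-reflexive refl ; sym = mod-sym ; trans = mod-trans }

  +-cong-mod : ∀ {a b c d} → a ≡ b [mod2^ K ] → c ≡ d [mod2^ K ] → a ℤ.+ c ≡ b ℤ.+ d [mod2^ K ]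
  +-cong-mod {a} {b} {c} {d} (mod2^ a≡b) (mod2^ c≡d) =
    mod2^ (subst (_ ∣_) (regroup a b c d) (ℤ∣.∣m∣n⇒∣m+n a≡b c≡d))
    where
    regroup : ∀ a b c d → (a ℤ.- b) ℤ.+ (c ℤ.- d) ≡ (a ℤ.+ c) ℤ.- (b ℤ.+ d)
    regroup = ℤ.solve-∀

  *-congˡ-mod : ∀ c {a b} → a ≡ b [mod2^ K ] → c ℤ.* a ≡ c ℤ.* b [mod2^ K ]
  *-congˡ-mod c {a} {b} (mod2^ a≡b) = mod2^ (subst (_ ∣_) (*-distribˡ-- c a b) (ℤ∣.∣n⇒∣m*n c a≡b))

  *-cong-mod : ∀ {a b c d} → a ≡ b [mod2^ K ] → c ≡ d [mod2^ K ] → a ℤ.* c ≡ b ℤ.* d [mod2^ K ]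
  *-cong-mod {a} {b} {c} {d} a≡b c≡d = mod-trans (*-congˡ-mod a c≡d)
    (subst₂ _≡_[mod2^ K ] (ℤ.*-comm d a) (ℤ.*-comm d b) (*-congˡ-mod d a≡b))

  -‿cong-mod : ∀ {a b} → a ≡ b [mod2^ K ] → ℤ.- a ≡ ℤ.- b [mod2^ K ]
  -‿cong-mod {a} {b} (mod2^ a≡b) = mod2^ (subst (_ ∣_) (negate a b) (ℤ∣.∣m⇒∣-m a≡b))
    where
    negate : ∀ a b → ℤ.- (a ℤ.- b) ≡ ℤ.- a ℤ.- ℤ.- b
    negate = ℤ.solve-∀

mod-setoid : ℕ → Setoid _ _
mod-setoid K = record { isEquivalence = mod-isEquivalence {K} }

module ≡-mod-Reasoning (K : ℕ) = SetoidReasoning (mod-setoid K)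

mod-cast : ∀ {K K′ a b} → K ≡ K′ → a ≡ b [mod2^ K ] → a ≡ b [mod2^ K′ ]
mod-cast refl a≡b = a≡b

mod-zero : ∀ a b → a ≡ b [mod2^ 0 ]
mod-zero a b = mod2^ (divides (a ℤ.- b) (sym (ℤ.*-identityʳ (a ℤ.- b))))

2^∣2^ : ∀ {K K′} → K ≤ K′ → + (2 ^ K) ∣ + (2 ^ K′)
2^∣2^ {K} K≤K′ with ℕ.m≤n⇒∃[o]m+o≡n K≤K′
... | j , refl = divides (+ (2 ^ j)) (begin
  + (2 ^ (K + j))         ≡⟨ cong +_ (ℕ.^-distribˡ-+-* 2 K j) ⟩
  + (2 ^ K * 2 ^ j)       ≡⟨ cong +_ (ℕ.*-comm (2 ^ K) (2 ^ j)) ⟩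
  + (2 ^ j * 2 ^ K)       ≡⟨ ℤ.pos-* (2 ^ j) (2 ^ K) ⟩
  + (2 ^ j) ℤ.* + (2 ^ K) ∎)
  where open ≡-Reasoning

mod-weaken : ∀ {K K′ a b} → K ≤ K′ → a ≡ b [mod2^ K′ ] → a ≡ b [mod2^ K ]
mod-weaken K≤K′ (mod2^ a≡b) = mod2^ (ℤ∣.∣-trans (2^∣2^ K≤K′) a≡b)

+2^-distrib : ∀ n H → + (2 ^ (n + H)) ≡ + (2 ^ n) ℤ.* + (2 ^ H)
+2^-distrib n H = trans (cong +_ (ℕ.^-distribˡ-+-* 2 n H)) (ℤ.pos-* (2 ^ n) (2 ^ H))

mod-shift : ∀ n {H a b} → a ≡ b [mod2^ H ] → + (2 ^ n) ℤ.* a ≡ + (2 ^ n) ℤ.* b [mod2^ n + H ]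
mod-shift n {H} {a} {b} (mod2^ a≡b) = mod2^
  (subst₂ _∣_ (sym (+2^-distrib n H)) (*-distribˡ-- (+ (2 ^ n)) a b) (ℤ∣.*-monoʳ-∣ (+ (2 ^ n)) a≡b))

mod-unshift : ∀ n {H a b} → + (2 ^ n) ℤ.* a ≡ + (2 ^ n) ℤ.* b [mod2^ n + H ] → a ≡ b [mod2^ H ]
mod-unshift n {H} {a} {b} (mod2^ 2ⁿa≡2ⁿb) = mod2^ (ℤ∣.*-cancelˡ-∣ (+ (2 ^ n)) {{ℕ.m^n≢0 2 n}}
  (subst₂ _∣_ (+2^-distrib n H) (sym (*-distribˡ-- (+ (2 ^ n)) a b)) 2ⁿa≡2ⁿb))

n∣m<n⇒m≡0 : ∀ {n m} .{{_ : NonZero n}} → n ℕ∣.∣ m → m < n → m ≡ 0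
n∣m<n⇒m≡0 {n} {m} n∣m m<n = trans (sym (m<n⇒m%n≡m m<n)) (n∣m⇒m%n≡0 m n n∣m)

residue-unique : ∀ {K r r′} → r < 2 ^ K → r′ < 2 ^ K → + r ≡ + r′ [mod2^ K ] → r ≡ r′
residue-unique {K} {r} {r′} r<2^K r′<2^K (mod2^ r≡r′) =
  ℤ.+-injective (ℤ.i-j≡0⇒i≡j (+ r) (+ r′) (ℤ.∣i∣≡0⇒i≡0 ∣r-r′∣≡0))
  where
  instance _ = ℕ.m^n≢0 2 K
  ∣r-r′∣<2^K : ∣ + r ℤ.- + r′ ∣ < 2 ^ K
  ∣r-r′∣<2^K = begin-strict
    ∣ + r ℤ.- + r′ ∣   ≡⟨ cong ∣_∣ (ℤ.[+m]-[+n]≡m⊖n r r′) ⟩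
    ∣ r ℤ.⊖ r′ ∣       ≤⟨ ℤ.∣m⊝n∣≤m⊔n r r′ ⟩
    r ℕ.⊔ r′           <⟨ ℕ.⊔-lub r<2^K r′<2^K ⟩
    2 ^ K              ∎
    where open ℕ.≤-Reasoning
  ∣r-r′∣≡0 : ∣ + r ℤ.- + r′ ∣ ≡ 0
  ∣r-r′∣≡0 = n∣m<n⇒m≡0 (ℤ∣.∣⇒∣ᵤ r≡r′) ∣r-r′∣<2^K

difference≡0⇒≡ : ∀ {K a b} → a ℤ.- b ≡ 0ℤ [mod2^ K ] → a ≡ b [mod2^ K ]
difference≡0⇒≡ {a = a} {b} (mod2^ 2^K∣a-b) = mod2^ (subst (_ ∣_) (ℤ.+-identityʳ (a ℤ.- b)) 2^K∣a-b)

≡⇒difference≡0 : ∀ {K a b} → a ≡ b [mod2^ K ] → a ℤ.- b ≡ 0ℤ [mod2^ K ]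
≡⇒difference≡0 {a = a} {b} (mod2^ 2^K∣a-b) = mod2^ (subst (_ ∣_) (sym (ℤ.+-identityʳ (a ℤ.- b))) 2^K∣a-b)

≡0⇒multiple : ∀ {K z} → z ≡ 0ℤ [mod2^ K ] → ∃ λ t → z ≡ + (2 ^ K) ℤ.* t
≡0⇒multiple {K} {z} (mod2^ (divides t z-0≡t*2^K)) =
  t , trans (sym (ℤ.+-identityʳ z)) (trans z-0≡t*2^K (ℤ.*-comm t (+ (2 ^ K))))

-- Odd integers

Odd : ℤ → Set
Odd a = a ≡ 1ℤ [mod2^ 1 ]

bitVal-%2 : ∀ n → bitVal (n % 2 ≡ᵇ 1) ≡ n % 2
bitVal-%2 n with n % 2 | m%n<n n 2
... | 0 | _ = refl
... | 1 | _ = refl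
... | suc (suc _) | s≤s (s≤s ())

+n≡+[n%2] : ∀ n → + n ≡ + (n % 2) [mod2^ 1 ]
+n≡+[n%2] n = mod2^ (divides (+ (n / 2)) (begin
  + n ℤ.- + r                     ≡⟨ cong (λ m → + m ℤ.- + r) (m≡m%n+[m/n]*n n 2) ⟩
  + (r + q * 2) ℤ.- + r           ≡⟨ cong (ℤ._- + r) (trans (ℤ.pos-+ r (q * 2)) (cong (ℤ._+_ (+ r)) (ℤ.pos-* q 2))) ⟩
  + r ℤ.+ + q ℤ.* + 2 ℤ.- + r     ≡⟨ cancel (+ r) (+ q ℤ.* + 2) ⟩
  + q ℤ.* + 2                     ∎))
  where
  open ≡-Reasoning
  r = n % 2
  q = n / 2
  cancel : ∀ r s → r ℤ.+ s ℤ.- r ≡ s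
  cancel = ℤ.solve-∀

i≡+∣i∣ : ∀ i → i ≡ + ∣ i ∣ [mod2^ 1 ]
i≡+∣i∣ (+ n)    = mod-reflexive refl
i≡+∣i∣ -[1+ n ] = mod2^ (divides (ℤ.- + suc n) (double (+ suc n)))
  where
  double : ∀ m → ℤ.- m ℤ.- m ≡ (ℤ.- m) ℤ.* + 2
  double = ℤ.solve-∀

digit : ℤ → Bool
digit a = ∣ a ∣ % 2 ≡ᵇ 1

parity : ∀ a → a ≡ + bitVal (digit a) [mod2^ 1 ]
parity a = begin
  a                       ≈⟨ i≡+∣i∣ a ⟩
  + ∣ a ∣                 ≈⟨ +n≡+[n%2] ∣ a ∣ ⟩
  + (∣ a ∣ % 2)           ≡⟨ cong +_ (bitVal-%2 ∣ a ∣) ⟨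
  + bitVal (digit a)      ∎
  where open ≡-mod-Reasoning 1

odd-%2 : ∀ {b} → b % 2 ≡ 1 → Odd (+ b)
odd-%2 {b} b%2≡1 = mod-trans (+n≡+[n%2] b) (mod-reflexive (cong +_ b%2≡1))

odd-* : ∀ {a b} → Odd a → Odd b → Odd (a ℤ.* b)
odd-* = *-cong-mod

odd-minus1 : Odd ℤ.-1ℤ
odd-minus1 = mod2^ (divides ℤ.-1ℤ refl)

odd-neg : ∀ {a} → Odd a → Odd (ℤ.- a)
odd-neg {a} odd = begin
  ℤ.- a                  ≡⟨ -1*i a ⟨
  ℤ.-1ℤ ℤ.* a            ≈⟨ *-cong-mod odd-minus1 odd ⟩
  1ℤ                     ∎
  where
  open ≡-mod-Reasoning 1
  -1*i : ∀ i → ℤ.-1ℤ ℤ.* i ≡ ℤ.- i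
  -1*i = ℤ.solve-∀

odd-3 : Odd (+ 3)
odd-3 = mod2^ (divides 1ℤ refl)

odd-3^ : ∀ k → Odd (+ (3 ^ k))
odd-3^ zero    = mod-reflexive refl
odd-3^ (suc k) = begin
  + (3 ^ suc k)         ≡⟨ ℤ.pos-* 3 (3 ^ k) ⟩
  + 3 ℤ.* + (3 ^ k)     ≈⟨ *-cong-mod odd-3 (odd-3^ k) ⟩
  1ℤ                    ∎
  where open ≡-mod-Reasoning 1

odd-cancel-≡0 : ∀ K {c z} → Odd c → c ℤ.* z ≡ 0ℤ [mod2^ K ] → z ≡ 0ℤ [mod2^ K ]
odd-cancel-≡0 zero    odd cz≡0 = mod-zero _ _
odd-cancel-≡0 (suc K) {c} {z} odd cz≡0
  with t , refl ← ≡0⇒multiple (odd-cancel-≡0 K odd (mod-weaken (ℕ.n≤1+n K) cz≡0)) =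
  mod-cast (ℕ.+-comm K 1) (mod-trans (mod-shift K t≡0) (mod-reflexive (ℤ.*-zeroʳ (+ (2 ^ K)))))
  where
  2ᴷct≡0 : + (2 ^ K) ℤ.* (c ℤ.* t) ≡ + (2 ^ K) ℤ.* 0ℤ [mod2^ K + 1 ]
  2ᴷct≡0 = begin
    + (2 ^ K) ℤ.* (c ℤ.* t)   ≡⟨ swap (+ (2 ^ K)) c t ⟩
    c ℤ.* (+ (2 ^ K) ℤ.* t)   ≈⟨ mod-cast (ℕ.+-comm 1 K) cz≡0 ⟩
    0ℤ                        ≡⟨ ℤ.*-zeroʳ (+ (2 ^ K)) ⟨
    + (2 ^ K) ℤ.* 0ℤ          ∎
    where
    open ≡-mod-Reasoning (K + 1)
    swap : ∀ p c t → p ℤ.* (c ℤ.* t) ≡ c ℤ.* (p ℤ.* t)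
    swap = ℤ.solve-∀
  t≡0 : t ≡ 0ℤ [mod2^ 1 ]
  t≡0 = begin
    t             ≡⟨ ℤ.*-identityˡ t ⟨
    1ℤ ℤ.* t      ≈⟨ *-cong-mod odd (mod-reflexive refl) ⟨
    c ℤ.* t       ≈⟨ mod-unshift K 2ᴷct≡0 ⟩
    0ℤ            ∎
    where open ≡-mod-Reasoning 1

odd-cancel : ∀ {K c a b} → Odd c → c ℤ.* a ≡ c ℤ.* b [mod2^ K ] → a ≡ b [mod2^ K ]
odd-cancel {K} {c} {a} {b} odd ca≡cb =
  difference≡0⇒≡ (odd-cancel-≡0 K odd (subst (_≡ 0ℤ [mod2^ K ]) (sym (*-distribˡ-- c a b)) (≡⇒difference≡0 ca≡cb)))

odd-divisor : ∀ {d m} → d ℕ∣.∣ m → Odd (+ m) → Odd (+ d)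
odd-divisor {d} {m} (ℕ∣.divides q m≡q*d) odd-m with digit (+ d) | parity (+ d)
... | true  | d≡1 = d≡1
... | false | d≡0 = ⊥-elim (ℕ.0≢1+n (residue-unique {1} {0} {1} (s≤s z≤n) (s≤s (s≤s z≤n)) (begin
  0ℤ                   ≡⟨ ℤ.*-zeroʳ (+ q) ⟨
  + q ℤ.* 0ℤ           ≈⟨ *-congˡ-mod (+ q) d≡0 ⟨
  + q ℤ.* + d          ≡⟨ ℤ.pos-* q d ⟨
  + (q * d)            ≡⟨ cong +_ m≡q*d ⟨
  + m                  ≈⟨ odd-m ⟩
  1ℤ                   ∎)))
  where open ≡-mod-Reasoning 1

square-≡1 : ∀ j {x} → x ≡ 1ℤ [mod2^ suc j ] → x ℤ.* x ≡ 1ℤ [mod2^ suc (suc j) ]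
square-≡1 j {x} x≡1 = from-multiples (≡0⇒multiple (≡⇒difference≡0 x≡1)) (≡0⇒multiple x+1≡0)
  where
  x+1≡0 : x ℤ.+ 1ℤ ≡ 0ℤ [mod2^ 1 ]
  x+1≡0 = mod-trans (+-cong-mod (mod-weaken (s≤s z≤n) x≡1) (mod-reflexive {a = 1ℤ} refl)) (mod2^ (divides 1ℤ refl))
  from-multiples : (∃ λ t → x ℤ.- 1ℤ ≡ + (2 ^ suc j) ℤ.* t) → (∃ λ u → x ℤ.+ 1ℤ ≡ + 2 ℤ.* u) →
    x ℤ.* x ≡ 1ℤ [mod2^ suc (suc j) ]
  from-multiples (t , x-1≡) (u , x+1≡) = mod2^ (divides (t ℤ.* u) (begin
    x ℤ.* x ℤ.- 1ℤ                              ≡⟨ difference-of-squares x ⟩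
    (x ℤ.- 1ℤ) ℤ.* (x ℤ.+ 1ℤ)                   ≡⟨ cong₂ ℤ._*_ x-1≡ x+1≡ ⟩
    (+ (2 ^ suc j) ℤ.* t) ℤ.* (+ 2 ℤ.* u)       ≡⟨ regroup (+ (2 ^ suc j)) t u ⟩
    t ℤ.* u ℤ.* (+ 2 ℤ.* + (2 ^ suc j))         ≡⟨ cong (ℤ._*_ (t ℤ.* u)) (ℤ.pos-* 2 (2 ^ suc j)) ⟨
    t ℤ.* u ℤ.* + (2 ^ suc (suc j))             ∎))
    where
    open ≡-Reasoning
    difference-of-squares : ∀ x → x ℤ.* x ℤ.- 1ℤ ≡ (x ℤ.- 1ℤ) ℤ.* (x ℤ.+ 1ℤ)
    difference-of-squares = ℤ.solve-∀
    regroup : ∀ p t u → (p ℤ.* t) ℤ.* (+ 2 ℤ.* u) ≡ t ℤ.* u ℤ.* (+ 2 ℤ.* p)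
    regroup = ℤ.solve-∀

3^2^j≡1 : ∀ j → + (3 ^ 2 ^ j) ≡ 1ℤ [mod2^ suc j ]
3^2^j≡1 zero    = odd-3
3^2^j≡1 (suc j) = begin
  + (3 ^ 2 ^ suc j)                       ≡⟨ cong (λ e → + (3 ^ (2 ^ j + e))) (ℕ.+-identityʳ (2 ^ j)) ⟩
  + (3 ^ (2 ^ j + 2 ^ j))                 ≡⟨ cong +_ (ℕ.^-distribˡ-+-* 3 (2 ^ j) (2 ^ j)) ⟩
  + (3 ^ 2 ^ j * 3 ^ 2 ^ j)               ≡⟨ ℤ.pos-* (3 ^ 2 ^ j) (3 ^ 2 ^ j) ⟩
  + (3 ^ 2 ^ j) ℤ.* + (3 ^ 2 ^ j)         ≈⟨ square-≡1 j (3^2^j≡1 j) ⟩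
  1ℤ                                      ∎
  where open ≡-mod-Reasoning (suc (suc j))

^-≡1 : ∀ {K X} → + X ≡ 1ℤ [mod2^ K ] → ∀ m → + (X ^ m) ≡ 1ℤ [mod2^ K ]
^-≡1         X≡1 zero    = mod-reflexive refl
^-≡1 {K} {X} X≡1 (suc m) = begin
  + (X * X ^ m)             ≡⟨ ℤ.pos-* X (X ^ m) ⟩
  + X ℤ.* + (X ^ m)         ≈⟨ *-cong-mod X≡1 (^-≡1 X≡1 m) ⟩
  1ℤ                        ∎
  where open ≡-mod-Reasoning K

3^-periodic : ∀ H k s → + (3 ^ (k + 2 ^ H * s)) ≡ + (3 ^ k) [mod2^ H ]
3^-periodic H k s = begin
  + (3 ^ (k + 2 ^ H * s))                   ≡⟨ cong +_ (ℕ.^-distribˡ-+-* 3 k (2 ^ H * s)) ⟩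
  + (3 ^ k * 3 ^ (2 ^ H * s))               ≡⟨ cong (λ m → + (3 ^ k * m)) (ℕ.^-*-assoc 3 (2 ^ H) s) ⟨
  + (3 ^ k * (3 ^ 2 ^ H) ^ s)               ≡⟨ ℤ.pos-* (3 ^ k) ((3 ^ 2 ^ H) ^ s) ⟩
  + (3 ^ k) ℤ.* + ((3 ^ 2 ^ H) ^ s)         ≈⟨ *-congˡ-mod (+ (3 ^ k)) (^-≡1 (mod-weaken (ℕ.n≤1+n H) (3^2^j≡1 H)) s) ⟩
  + (3 ^ k) ℤ.* 1ℤ                          ≡⟨ ℤ.*-identityʳ (+ (3 ^ k)) ⟩
  + (3 ^ k)                                 ∎
  where open ≡-mod-Reasoning H

-- 2-adic expansions of fractions

Expansion : ℤ → ℤ → ℤ₂ → Set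
Expansion a b x = ∀ M → b ℤ.* + L M x ≡ a [mod2^ M ]

expansion-scale : ∀ c {a b x} → Expansion a b x → Expansion (c ℤ.* a) (c ℤ.* b) x
expansion-scale c {a} {b} {x} b/a M = begin
  c ℤ.* b ℤ.* + L M x       ≡⟨ ℤ.*-assoc c b (+ L M x) ⟩
  c ℤ.* (b ℤ.* + L M x)     ≈⟨ *-congˡ-mod c (b/a M) ⟩
  c ℤ.* a                   ∎
  where open ≡-mod-Reasoning M

expansion-cancel : ∀ {c a b x} → Odd c → Expansion (c ℤ.* a) (c ℤ.* b) x → Expansion a b x
expansion-cancel {c} {a} {b} {x} odd cb/ca M =
  odd-cancel odd (subst (_≡ c ℤ.* a [mod2^ M ]) (ℤ.*-assoc c b (+ L M x)) (cb/ca M))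

expansion-L-unique : ∀ {a b a′ b′ x y} M → Odd b → Expansion a b x → Expansion a′ b′ y →
  a ≡ a′ [mod2^ M ] → b ≡ b′ [mod2^ M ] → L M x ≡ L M y
expansion-L-unique {a} {b} {a′} {b′} {x} {y} M odd b/a b′/a′ a≡a′ b≡b′ =
  residue-unique (L<2^ M x) (L<2^ M y) (odd-cancel odd (begin
    b ℤ.* + L M x      ≈⟨ b/a M ⟩
    a                  ≈⟨ a≡a′ ⟩
    a′                 ≈⟨ b′/a′ M ⟨
    b′ ℤ.* + L M y     ≈⟨ *-cong-mod b≡b′ (mod-reflexive refl) ⟨
    b ℤ.* + L M y      ∎))
  where open ≡-mod-Reasoning M

+L-+ : ∀ m n x → + L (m + n) x ≡ + L m x ℤ.+ + (2 ^ m) ℤ.* + L n (R m x)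
+L-+ m n x = trans (cong +_ (L-+ m n x)) (trans (ℤ.pos-+ (L m x) _) (cong (ℤ._+_ (+ L m x)) (ℤ.pos-* (2 ^ m) _)))

2^n*e≡0 : ∀ n e → + (2 ^ n) ℤ.* e ≡ 0ℤ [mod2^ n ]
2^n*e≡0 n e = mod2^ (divides e (trans (ℤ.+-identityʳ _) (ℤ.*-comm (+ (2 ^ n)) e)))

expansion-shift-+ : ∀ n H {B c e x z t} → Odd B →
  Expansion (c ℤ.+ + (2 ^ n) ℤ.* e) B x → Expansion c B z → Expansion e B t →
  + L H (R n x) ≡ + L H (R n z) ℤ.+ + L H t [mod2^ H ]
expansion-shift-+ n H {B} {c} {e} {x} {z} {t} odd B/x B/z B/t =
  odd-cancel odd (mod-unshift n (begin
    P ℤ.* (B ℤ.* x′)                                 ≡⟨ isolate-tail B ℓ P x′ ⟩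
    B ℤ.* (ℓ ℤ.+ P ℤ.* x′) ℤ.- B ℤ.* ℓ               ≡⟨ cong (λ u → B ℤ.* u ℤ.- B ℤ.* ℓ) (+L-+ n H x) ⟨
    B ℤ.* + L (n + H) x ℤ.- B ℤ.* ℓ                  ≈⟨ +-cong-mod (B/x (n + H)) (mod-reflexive refl) ⟩
    c ℤ.+ P ℤ.* e ℤ.- B ℤ.* ℓ                        ≈⟨ +-cong-mod (+-cong-mod (B/z (n + H)) (mod-shift n (B/t H))) (mod-reflexive refl) ⟨
    B ℤ.* + L (n + H) z ℤ.+ P ℤ.* (B ℤ.* τ) ℤ.- B ℤ.* ℓ
                                                     ≡⟨ cong (λ u → B ℤ.* u ℤ.+ P ℤ.* (B ℤ.* τ) ℤ.- B ℤ.* ℓ) z-split ⟩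
    B ℤ.* (ℓ ℤ.+ P ℤ.* z′) ℤ.+ P ℤ.* (B ℤ.* τ) ℤ.- B ℤ.* ℓ
                                                     ≡⟨ combine-tails B ℓ P z′ τ ⟩
    P ℤ.* (B ℤ.* (z′ ℤ.+ τ))                         ∎))
  where
  open ≡-mod-Reasoning (n + H)
  P  = + (2 ^ n)
  ℓ  = + L n x
  x′ = + L H (R n x)
  z′ = + L H (R n z)
  τ  = + L H t
  Lx≡Lz : L n x ≡ L n z
  Lx≡Lz = expansion-L-unique n odd B/x B/z
    (mod-trans (+-cong-mod (mod-reflexive {a = c} refl) (2^n*e≡0 n e)) (mod-reflexive (ℤ.+-identityʳ c)))
    (mod-reflexive refl)
  z-split : + L (n + H) z ≡ ℓ ℤ.+ P ℤ.* z′
  z-split = trans (+L-+ n H z) (cong (λ l → + l ℤ.+ P ℤ.* z′) (sym Lx≡Lz))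
  isolate-tail : ∀ B ℓ P x′ → P ℤ.* (B ℤ.* x′) ≡ B ℤ.* (ℓ ℤ.+ P ℤ.* x′) ℤ.- B ℤ.* ℓ
  isolate-tail = ℤ.solve-∀
  combine-tails : ∀ B ℓ P z′ τ → B ℤ.* (ℓ ℤ.+ P ℤ.* z′) ℤ.+ P ℤ.* (B ℤ.* τ) ℤ.- B ℤ.* ℓ ≡ P ℤ.* (B ℤ.* (z′ ℤ.+ τ))
  combine-tails = ℤ.solve-∀

[i*d]/ℕd≡i : ∀ i d .{{_ : NonZero d}} → (i ℤ.* + d) /ℕ d ≡ i
[i*d]/ℕd≡i i d = sym (ℤ.*-cancelʳ-≡ i q (+ d) (begin
  i ℤ.* + d                    ≡⟨ a≡a%ℕn+[a/ℕn]*n (i ℤ.* + d) d ⟩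
  + r ℤ.+ q ℤ.* + d            ≡⟨ cong (λ m → + m ℤ.+ q ℤ.* + d) r≡0 ⟩
  0ℤ ℤ.+ q ℤ.* + d             ≡⟨ ℤ.+-identityˡ (q ℤ.* + d) ⟩
  q ℤ.* + d                    ∎))
  where
  open ≡-Reasoning
  q = (i ℤ.* + d) /ℕ d
  r = (i ℤ.* + d) %ℕ d
  +r≡[i-q]*d : + r ≡ (i ℤ.- q) ℤ.* + d
  +r≡[i-q]*d = begin
    + r                                 ≡⟨ isolate (+ r) (q ℤ.* + d) ⟩
    (+ r ℤ.+ q ℤ.* + d) ℤ.- q ℤ.* + d   ≡⟨ cong (ℤ._- q ℤ.* + d) (a≡a%ℕn+[a/ℕn]*n (i ℤ.* + d) d) ⟨
    i ℤ.* + d ℤ.- q ℤ.* + d             ≡⟨ factor i q (+ d) ⟩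
    (i ℤ.- q) ℤ.* + d                   ∎
    where
    isolate : ∀ r s → r ≡ (r ℤ.+ s) ℤ.- s
    isolate = ℤ.solve-∀
    factor : ∀ i q d → i ℤ.* d ℤ.- q ℤ.* d ≡ (i ℤ.- q) ℤ.* d
    factor = ℤ.solve-∀
  r≡0 : r ≡ 0
  r≡0 = n∣m<n⇒m≡0 (ℤ∣.∣⇒∣ᵤ (divides (i ℤ.- q) +r≡[i-q]*d)) (n%ℕd<d (i ℤ.* + d) d)

nextNumerator : ℕ → ℤ → ℤ
nextNumerator b a = (a ℤ.- (if digit a then + b else + 0)) /ℕ 2

if-digit : ∀ d b → (if d then + b else + 0) ≡ + bitVal d ℤ.* + b
if-digit true  b = sym (ℤ.*-identityˡ (+ b))
if-digit false b = refl

digit-parity : ∀ {b} → Odd (+ b) → ∀ a → a ≡ + bitVal (digit a) ℤ.* + b [mod2^ 1 ]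
digit-parity {b} odd a = begin
  a                          ≈⟨ parity a ⟩
  d                          ≡⟨ ℤ.*-identityʳ d ⟨
  d ℤ.* 1ℤ                   ≈⟨ *-congˡ-mod d odd ⟨
  d ℤ.* + b                  ∎
  where
  open ≡-mod-Reasoning 1
  d = + bitVal (digit a)

numerator-step : ∀ {b} → Odd (+ b) → ∀ a →
  a ≡ + bitVal (digit a) ℤ.* + b ℤ.+ + 2 ℤ.* nextNumerator b a
numerator-step {b} odd a = from-multiple (≡0⇒multiple (≡⇒difference≡0 (digit-parity odd a)))
  where
  db = + bitVal (digit a) ℤ.* + b
  from-multiple : (∃ λ t → a ℤ.- db ≡ + 2 ℤ.* t) → a ≡ db ℤ.+ + 2 ℤ.* nextNumerator b a
  from-multiple (t , a-db≡2t) = begin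
    a                                      ≡⟨ split a db ⟩
    db ℤ.+ (a ℤ.- db)                      ≡⟨ cong (ℤ._+_ db) a-db≡2t ⟩
    db ℤ.+ + 2 ℤ.* t                       ≡⟨ cong (λ u → db ℤ.+ + 2 ℤ.* u) t≡next ⟩
    db ℤ.+ + 2 ℤ.* nextNumerator b a       ∎
    where
    open ≡-Reasoning
    split : ∀ a c → a ≡ c ℤ.+ (a ℤ.- c)
    split = ℤ.solve-∀
    t≡next : t ≡ nextNumerator b a
    t≡next = begin
      t                     ≡⟨ [i*d]/ℕd≡i t 2 ⟨
      (t ℤ.* + 2) /ℕ 2      ≡⟨ cong (_/ℕ 2) (ℤ.*-comm t (+ 2)) ⟩
      (+ 2 ℤ.* t) /ℕ 2      ≡⟨ cong (_/ℕ 2) (trans (sym a-db≡2t) (cong (ℤ._-_ a) (sym (if-digit (digit a) b)))) ⟩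
      nextNumerator b a     ∎

ratDigits-expansion : ∀ {b} → Odd (+ b) → ∀ a → Expansion a (+ b) (ratDigits a b)
ratDigits-expansion odd a zero    = mod-zero _ _
ratDigits-expansion {b} odd a (suc M) = begin
  + b ℤ.* + L (suc M) x                          ≡⟨ cong (λ n → + b ℤ.* + n) (L-head M x) ⟩
  + b ℤ.* + (bitVal (x 0) + 2 * L M (σ x))       ≡⟨ cong (ℤ._*_ (+ b)) cast ⟩
  + b ℤ.* (d ℤ.+ + 2 ℤ.* + L M (σ x))            ≡⟨ distribute (+ b) d (+ L M (σ x)) ⟩
  d ℤ.* + b ℤ.+ + 2 ℤ.* (+ b ℤ.* + L M (σ x))    ≈⟨ +-cong-mod (mod-reflexive {a = d ℤ.* + b} refl) (mod-shift 1 tail) ⟩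
  d ℤ.* + b ℤ.+ + 2 ℤ.* nextNumerator b a        ≡⟨ numerator-step odd a ⟨
  a                                              ∎
  where
  open ≡-mod-Reasoning (suc M)
  x = ratDigits a b
  d = + bitVal (x 0)
  cast : + (bitVal (x 0) + 2 * L M (σ x)) ≡ d ℤ.+ + 2 ℤ.* + L M (σ x)
  cast = trans (ℤ.pos-+ (bitVal (x 0)) (2 * L M (σ x))) (cong (ℤ._+_ d) (ℤ.pos-* 2 (L M (σ x))))
  tail : + b ℤ.* + L M (σ x) ≡ nextNumerator b a [mod2^ M ]
  tail = ratDigits-expansion odd (nextNumerator b a) M
  distribute : ∀ b d l → b ℤ.* (d ℤ.+ + 2 ℤ.* l) ≡ d ℤ.* b ℤ.+ + 2 ℤ.* (b ℤ.* l)
  distribute = ℤ.solve-∀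

-- ratDigits expects a positive denominator, so a negative one is flipped.
fractionDigits : ℤ → ℤ → ℤ₂
fractionDigits a (+ b)    = ratDigits a b
fractionDigits a -[1+ b ] = ratDigits (ℤ.- a) (suc b)

fractionDigits-expansion : ∀ {b} → Odd b → ∀ a → Expansion a b (fractionDigits a b)
fractionDigits-expansion {+ b}    odd a = ratDigits-expansion odd a
fractionDigits-expansion { -[1+ b ]} odd a = subst₂ (λ u v → Expansion u v x) (neg-neg a) (-1*i (+ suc b)) scaled
  where
  x = ratDigits (ℤ.- a) (suc b)
  scaled : Expansion (ℤ.-1ℤ ℤ.* ℤ.- a) (ℤ.-1ℤ ℤ.* + suc b) x
  scaled = expansion-scale ℤ.-1ℤ {ℤ.- a} {+ suc b} (ratDigits-expansion {suc b} (odd-neg odd) (ℤ.- a))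
  -1*i : ∀ i → ℤ.-1ℤ ℤ.* i ≡ ℤ.- i
  -1*i = ℤ.solve-∀
  neg-neg : ∀ i → ℤ.-1ℤ ℤ.* ℤ.- i ≡ i
  neg-neg = ℤ.solve-∀

-- Eventual periodicity

PeriodicFrom : ℕ → ℕ → ℤ₂ → Set
PeriodicFrom N p x = ∀ i → N ≤ i → x (i + p) ≡ x i

EventuallyPeriodicDigits : ℤ₂ → Set
EventuallyPeriodicDigits x = Σ ℕ λ N → Σ ℕ λ p → 0 < p × PeriodicFrom N p x

periodic-multiple : ∀ {N p x} → PeriodicFrom N p x → ∀ t i → N ≤ i → x (i + t * p) ≡ x i
periodic-multiple {x = x} per zero    i N≤i = cong x (ℕ.+-identityʳ i)
periodic-multiple {N} {p} {x} per (suc t) i N≤i = begin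
  x (i + (p + t * p))     ≡⟨ cong x (reorder i p (t * p)) ⟩
  x (i + t * p + p)       ≡⟨ per (i + t * p) (ℕ.≤-trans N≤i (ℕ.m≤m+n i (t * p))) ⟩
  x (i + t * p)           ≡⟨ periodic-multiple per t i N≤i ⟩
  x i                     ∎
  where
  open ≡-Reasoning
  reorder : ∀ i p q → i + (p + q) ≡ i + q + p
  reorder = solve-∀

R-periodic : ∀ {N p x} → PeriodicFrom N p x → ∀ t {n} → N ≤ n → ∀ i → R (n + t * p) x i ≡ R n x i
R-periodic {N} {p} {x} per t {n} N≤n i = begin
  R (n + t * p) x i         ≡⟨ R-apply (n + t * p) x i ⟩
  x (n + t * p + i)         ≡⟨ cong x (swap n (t * p) i) ⟩
  x (n + i + t * p)         ≡⟨ periodic-multiple per t (n + i) (ℕ.≤-trans N≤n (ℕ.m≤m+n n i)) ⟩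
  x (n + i)                 ≡⟨ R-apply n x i ⟨
  R n x i                   ∎
  where
  open ≡-Reasoning
  swap : ∀ n q i → n + q + i ≡ n + i + q
  swap = solve-∀

L-R-periodic : ∀ {N p x} → PeriodicFrom N p x → ∀ H t {n} → N ≤ n → L H (R (n + t * p) x) ≡ L H (R n x)
L-R-periodic per H t N≤n = L-cong H λ i _ → R-periodic per t N≤n i

iterate-+ : ∀ {A : Set} (f : A → A) a m n → iterate f a (m + n) ≡ iterate f (iterate f a m) n
iterate-+ f a zero    n = refl
iterate-+ f a (suc m) n = iterate-+ f (f a) m n

iterate-periodic : ∀ {A : Set} (f : A → A) a {i j} → i < j → iterate f a i ≡ iterate f a j →
  ∀ n → i ≤ n → iterate f a (n + (j ∸ i)) ≡ iterate f a n
iterate-periodic f a {i} {j} i<j fⁱa≡fʲa n i≤n with k , refl ← ℕ.m≤n⇒∃[o]m+o≡n i≤n = begin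
  iterate f a (i + k + (j ∸ i))        ≡⟨ cong (iterate f a) (reorder i k j (ℕ.<⇒≤ i<j)) ⟩
  iterate f a (j + k)                  ≡⟨ iterate-+ f a j k ⟩
  iterate f (iterate f a j) k          ≡⟨ cong (λ b → iterate f b k) fⁱa≡fʲa ⟨
  iterate f (iterate f a i) k          ≡⟨ iterate-+ f a i k ⟨
  iterate f a (i + k)                  ∎
  where
  open ≡-Reasoning
  reorder : ∀ i k j → i ≤ j → i + k + (j ∸ i) ≡ j + k
  reorder i k j i≤j = begin
    i + k + (j ∸ i)     ≡⟨ ℕ.+-assoc i k (j ∸ i) ⟩
    i + (k + (j ∸ i))   ≡⟨ cong (_+_ i) (ℕ.+-comm k (j ∸ i)) ⟩
    i + ((j ∸ i) + k)   ≡⟨ ℕ.+-assoc i (j ∸ i) k ⟨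
    i + (j ∸ i) + k     ≡⟨ cong (_+ k) (ℕ.m+[n∸m]≡n i≤j) ⟩
    j + k               ∎

encode : ℕ → ℤ → ℕ
encode B (+ n)    = n
encode B -[1+ n ] = suc B + n

encode< : ∀ B z → ∣ z ∣ ≤ B → encode B z < suc (2 * B)
encode< B (+ n)    n≤B = s≤s (ℕ.≤-trans n≤B (ℕ.m≤m+n B (B + 0)))
encode< B -[1+ n ] n<B = s≤s (begin
  suc (B + n)     ≡⟨ ℕ.+-suc B n ⟨
  B + suc n       ≤⟨ ℕ.+-monoʳ-≤ B n<B ⟩
  B + B           ≡⟨ cong (_+_ B) (ℕ.+-identityʳ B) ⟨
  2 * B           ∎)
  where open ℕ.≤-Reasoning

encode-injective : ∀ B {z z′} → ∣ z ∣ ≤ B → ∣ z′ ∣ ≤ B → encode B z ≡ encode B z′ → z ≡ z′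
encode-injective B {+ n}    {+ n′}    _   _   n≡n′ = cong +_ n≡n′
encode-injective B {+ n}    { -[1+ n′ ]} n≤B _   n≡  = ⊥-elim (ℕ.<-irrefl n≡ (s≤s (ℕ.≤-trans n≤B (ℕ.m≤m+n B n′))))
encode-injective B { -[1+ n ]} {+ n′}    _   n′≤B ≡n′ = ⊥-elim (ℕ.<-irrefl (sym ≡n′) (s≤s (ℕ.≤-trans n′≤B (ℕ.m≤m+n B n))))
encode-injective B { -[1+ n ]} { -[1+ n′ ]} _ _ eq  = cong -[1+_] (ℕ.+-cancelˡ-≡ (suc B) n n′ eq)

bounded-repeats : ∀ B (g : ℕ → ℤ) → (∀ i → ∣ g i ∣ ≤ B) → ∃₂ λ i j → i < j × g i ≡ g j
bounded-repeats B g bounded = repeat (Fin.pigeonhole (ℕ.n<1+n (suc (2 * B))) code)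
  where
  code : Fin (suc (suc (2 * B))) → Fin (suc (2 * B))
  code k = fromℕ< (encode< B (g (toℕ k)) (bounded (toℕ k)))
  repeat : (∃₂ λ i j → i Fin.< j × code i ≡ code j) → ∃₂ λ i j → i < j × g i ≡ g j
  repeat (i , j , i<j , ci≡cj) = toℕ i , toℕ j , i<j ,
    encode-injective B {g (toℕ i)} {g (toℕ j)} (bounded (toℕ i)) (bounded (toℕ j)) (begin
      encode B (g (toℕ i))       ≡⟨ Fin.toℕ-fromℕ< (encode< B (g (toℕ i)) (bounded (toℕ i))) ⟨
      toℕ (code i)               ≡⟨ cong toℕ ci≡cj ⟩
      toℕ (code j)               ≡⟨ Fin.toℕ-fromℕ< (encode< B (g (toℕ j)) (bounded (toℕ j))) ⟩
      encode B (g (toℕ j))       ∎)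
    where open ≡-Reasoning

ratDigits-iterate : ∀ a b i → ratDigits a b i ≡ digit (iterate (nextNumerator b) a i)
ratDigits-iterate a b zero    = refl
ratDigits-iterate a b (suc i) = ratDigits-iterate (nextNumerator b a) b i

nextNumerator-bounded : ∀ {b B} → Odd (+ b) → b ≤ B → ∀ {a} → ∣ a ∣ ≤ B → ∣ nextNumerator b a ∣ ≤ B
nextNumerator-bounded {b} {B} odd b≤B {a} a≤B = ℕ.*-cancelˡ-≤ 2 (begin
  2 * ∣ nextNumerator b a ∣      ≡⟨ ℤ.abs-* (+ 2) (nextNumerator b a) ⟨
  ∣ + 2 ℤ.* nextNumerator b a ∣  ≡⟨ cong ∣_∣ (isolate a db (+ 2 ℤ.* nextNumerator b a) (numerator-step odd a)) ⟩
  ∣ a ℤ.- db ∣                   ≤⟨ ℤ.∣i-j∣≤∣i∣+∣j∣ a db ⟩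
  ∣ a ∣ + ∣ db ∣                 ≡⟨ cong (λ n → ∣ a ∣ + n) (ℤ.abs-* d (+ b)) ⟩
  ∣ a ∣ + bitVal (digit a) * b   ≤⟨ ℕ.+-mono-≤ a≤B db≤B ⟩
  B + B                          ≡⟨ cong (_+_ B) (ℕ.+-identityʳ B) ⟨
  2 * B                          ∎)
  where
  open ℕ.≤-Reasoning
  d  = + bitVal (digit a)
  db = d ℤ.* + b
  db≤B : bitVal (digit a) * b ≤ B
  db≤B = ℕ.≤-trans (ℕ.*-monoˡ-≤ b (bitVal≤1 (digit a))) (ℕ.≤-trans (ℕ.≤-reflexive (ℕ.*-identityˡ b)) b≤B)
  isolate : ∀ a u v → a ≡ u ℤ.+ v → v ≡ a ℤ.- u
  isolate a u v refl = solve u v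
    where
    solve : ∀ u v → v ≡ u ℤ.+ v ℤ.- u
    solve = ℤ.solve-∀

ratDigits-eventuallyPeriodic : ∀ {b} → Odd (+ b) → ∀ a → EventuallyPeriodicDigits (ratDigits a b)
ratDigits-eventuallyPeriodic {b} odd a = periodic (bounded-repeats B s bounded)
  where
  B = ∣ a ∣ + b
  s = iterate (nextNumerator b) a
  bounded-from : ∀ {a′} → ∣ a′ ∣ ≤ B → ∀ k → ∣ iterate (nextNumerator b) a′ k ∣ ≤ B
  bounded-from a′≤B zero    = a′≤B
  bounded-from {a′} a′≤B (suc k) = bounded-from (nextNumerator-bounded odd (ℕ.m≤n+m b ∣ a ∣) {a′} a′≤B) k
  bounded : ∀ k → ∣ s k ∣ ≤ B
  bounded = bounded-from (ℕ.m≤m+n ∣ a ∣ b)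
  periodic : (∃₂ λ i j → i < j × s i ≡ s j) → EventuallyPeriodicDigits (ratDigits a b)
  periodic (i , j , i<j , sᵢ≡sⱼ) = i , j ∸ i , ℕ.m<n⇒0<n∸m i<j , λ n i≤n → begin
    ratDigits a b (n + (j ∸ i))      ≡⟨ ratDigits-iterate a b (n + (j ∸ i)) ⟩
    digit (s (n + (j ∸ i)))          ≡⟨ cong digit (iterate-periodic (nextNumerator b) a i<j sᵢ≡sⱼ n i≤n) ⟩
    digit (s n)                      ≡⟨ ratDigits-iterate a b n ⟨
    ratDigits a b n                  ∎
    where open ≡-Reasoning

fractionDigits-eventuallyPeriodic : ∀ {b} → Odd b → ∀ a → EventuallyPeriodicDigits (fractionDigits a b)
fractionDigits-eventuallyPeriodic {+ b}      odd a = ratDigits-eventuallyPeriodic odd a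
fractionDigits-eventuallyPeriodic { -[1+ b ]} odd a = ratDigits-eventuallyPeriodic (odd-neg odd) (ℤ.- a)

-- Φ on truncations

ι : ℕ → ℚ
ι n = + n ℚ./ 1

toℚᵘ-ι : ∀ n → toℚᵘ (ι n) ℚᵘ.≃ mkℚᵘ (+ n) 0
toℚᵘ-ι n = ℚ.toℚᵘ-fromℚᵘ (mkℚᵘ (+ n) 0)

ι-+ : ∀ m n → ι (m + n) ≡ ι m ℚ.+ ι n
ι-+ m n = ℚ.toℚᵘ-injective (begin
  toℚᵘ (ι (m + n))                        ≈⟨ toℚᵘ-ι (m + n) ⟩
  mkℚᵘ (+ (m + n)) 0                      ≈⟨ *≡* (cong (ℤ._* 1ℤ) numerators) ⟩
  mkℚᵘ (+ m) 0 ℚᵘ.+ mkℚᵘ (+ n) 0          ≈⟨ ℚᵘ.+-cong (toℚᵘ-ι m) (toℚᵘ-ι n) ⟨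
  toℚᵘ (ι m) ℚᵘ.+ toℚᵘ (ι n)              ≈⟨ ℚ.toℚᵘ-homo-+ (ι m) (ι n) ⟨
  toℚᵘ (ι m ℚ.+ ι n)                      ∎)
  where
  open ℚᵘ.≃-Reasoning
  numerators : + (m + n) ≡ + m ℤ.* 1ℤ ℤ.+ + n ℤ.* 1ℤ
  numerators = trans (ℤ.pos-+ m n) (sym (cong₂ ℤ._+_ (ℤ.*-identityʳ (+ m)) (ℤ.*-identityʳ (+ n))))

ι-* : ∀ m n → ι (m * n) ≡ ι m ℚ.* ι n
ι-* m n = ℚ.toℚᵘ-injective (begin
  toℚᵘ (ι (m * n))                        ≈⟨ toℚᵘ-ι (m * n) ⟩
  mkℚᵘ (+ (m * n)) 0                      ≈⟨ *≡* (cong (ℤ._* 1ℤ) (ℤ.pos-* m n)) ⟩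
  mkℚᵘ (+ m) 0 ℚᵘ.* mkℚᵘ (+ n) 0          ≈⟨ ℚᵘ.*-cong (toℚᵘ-ι m) (toℚᵘ-ι n) ⟨
  toℚᵘ (ι m) ℚᵘ.* toℚᵘ (ι n)              ≈⟨ ℚ.toℚᵘ-homo-* (ι m) (ι n) ⟨
  toℚᵘ (ι m ℚ.* ι n)                      ∎)
  where open ℚᵘ.≃-Reasoning

ones : ℕ → ℤ₂ → ℕ
ones zero    x = 0
ones (suc n) x = ones n x + bitVal (x n)

ones-cong : ∀ n {x y} → (∀ i → i < n → x i ≡ y i) → ones n x ≡ ones n y
ones-cong zero    x≈y = refl
ones-cong (suc n) x≈y = cong₂ _+_ (ones-cong n λ i i<n → x≈y i (ℕ.m<n⇒m<1+n i<n)) (cong bitVal (x≈y n ℕ.≤-refl))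

ones-+ : ∀ m n x → ones (m + n) x ≡ ones m x + ones n (R m x)
ones-+ m zero    x = trans (cong (λ k → ones k x) (ℕ.+-identityʳ m)) (sym (ℕ.+-identityʳ (ones m x)))
ones-+ m (suc n) x = begin
  ones (m + suc n) x                                 ≡⟨ cong (λ k → ones k x) (ℕ.+-suc m n) ⟩
  ones (m + n) x + bitVal (x (m + n))                ≡⟨ cong₂ _+_ (ones-+ m n x) (cong bitVal (sym (R-apply m x n))) ⟩
  ones m x + ones n (R m x) + bitVal (R m x n)       ≡⟨ ℕ.+-assoc (ones m x) _ _ ⟩
  ones m x + ones (suc n) (R m x)                    ∎
  where open ≡-Reasoning

Φnumerator : ℕ → ℤ₂ → ℕ
Φnumerator zero    x = 0
Φnumerator (suc n) x = 3 ^ bitVal (x n) * (Φnumerator n x + bitVal (x n) * 2 ^ n)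

Φnumerator-cong : ∀ n {x y} → (∀ i → i < n → x i ≡ y i) → Φnumerator n x ≡ Φnumerator n y
Φnumerator-cong zero    x≈y = refl
Φnumerator-cong (suc n) x≈y =
  cong₂ (λ b P → 3 ^ bitVal b * (P + bitVal b * 2 ^ n)) (x≈y n ℕ.≤-refl) (Φnumerator-cong n λ i i<n → x≈y i (ℕ.m<n⇒m<1+n i<n))

Φnumerator-+ : ∀ m n x →
  Φnumerator (m + n) x ≡ 3 ^ ones n (R m x) * Φnumerator m x + 2 ^ m * Φnumerator n (R m x)
Φnumerator-+ m zero    x = begin
  Φnumerator (m + 0) x                         ≡⟨ cong (λ k → Φnumerator k x) (ℕ.+-identityʳ m) ⟩
  Φnumerator m x                               ≡⟨ unit (Φnumerator m x) (2 ^ m) ⟩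
  1 * Φnumerator m x + 2 ^ m * 0               ∎
  where
  open ≡-Reasoning
  unit : ∀ P e → P ≡ 1 * P + e * 0
  unit = solve-∀
Φnumerator-+ m (suc n) x = begin
  Φnumerator (m + suc n) x
    ≡⟨ cong (λ k → Φnumerator k x) (ℕ.+-suc m n) ⟩
  3 ^ bitVal (x (m + n)) * (Φnumerator (m + n) x + bitVal (x (m + n)) * 2 ^ (m + n))
    ≡⟨ cong (λ d → 3 ^ bitVal d * (Φnumerator (m + n) x + bitVal d * 2 ^ (m + n))) (R-apply m x n) ⟨
  3 ^ b * (Φnumerator (m + n) x + b * 2 ^ (m + n))
    ≡⟨ cong₂ (λ P e → 3 ^ b * (P + b * e)) (Φnumerator-+ m n x) (ℕ.^-distribˡ-+-* 2 m n) ⟩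
  3 ^ b * (3 ^ K * Pm + 2 ^ m * Pn + b * (2 ^ m * 2 ^ n))
    ≡⟨ regroup (3 ^ b) (3 ^ K) Pm (2 ^ m) Pn b (2 ^ n) ⟩
  3 ^ K * 3 ^ b * Pm + 2 ^ m * (3 ^ b * (Pn + b * 2 ^ n))
    ≡⟨ cong (λ u → u * Pm + 2 ^ m * Φnumerator (suc n) (R m x)) (ℕ.^-distribˡ-+-* 3 K b) ⟨
  3 ^ ones (suc n) (R m x) * Pm + 2 ^ m * Φnumerator (suc n) (R m x)
    ∎
  where
  open ≡-Reasoning
  b  = bitVal (R m x n)
  K  = ones n (R m x)
  Pm = Φnumerator m x
  Pn = Φnumerator n (R m x)
  regroup : ∀ T S P E Q b F → T * (S * P + E * Q + b * (E * F)) ≡ S * T * P + E * (T * (Q + b * F))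
  regroup = solve-∀

length-positions : ∀ n x → length (positions x n) ≡ ones n x
length-positions zero    x = refl
length-positions (suc n) x = trans (List.length-++ (positions x n)) (cong₂ _+_ (length-positions n x) (last (x n)))
  where
  last : ∀ b → length (if b then [ n ] else []) ≡ bitVal b
  last true  = refl
  last false = refl

Φsum-snoc : ∀ j l e → Φsum j (l ++ [ e ]) ≡ Φsum j l ℚ.+ ι (2 ^ e) ℚ.* powℚ third (j + length l)
Φsum-snoc j []      e = begin
  ι (2 ^ e) ℚ.* powℚ third j ℚ.+ 0ℚ               ≡⟨ ℚ.+-identityʳ _ ⟩
  ι (2 ^ e) ℚ.* powℚ third j                      ≡⟨ cong (λ k → ι (2 ^ e) ℚ.* powℚ third k) (ℕ.+-identityʳ j) ⟨
  ι (2 ^ e) ℚ.* powℚ third (j + 0)                ≡⟨ ℚ.+-identityˡ _ ⟨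
  0ℚ ℚ.+ ι (2 ^ e) ℚ.* powℚ third (j + 0)         ∎
  where open ≡-Reasoning
Φsum-snoc j (e′ ∷ l) e = begin
  u ℚ.+ Φsum (suc j) (l ++ [ e ])                              ≡⟨ cong (u ℚ.+_) (Φsum-snoc (suc j) l e) ⟩
  u ℚ.+ (Φsum (suc j) l ℚ.+ ι (2 ^ e) ℚ.* powℚ third (suc j + length l))
                                                               ≡⟨ ℚ.+-assoc u _ _ ⟨
  u ℚ.+ Φsum (suc j) l ℚ.+ ι (2 ^ e) ℚ.* powℚ third (suc j + length l)
                                                               ≡⟨ cong (λ k → u ℚ.+ Φsum (suc j) l ℚ.+ ι (2 ^ e) ℚ.* powℚ third k) (ℕ.+-suc j (length l)) ⟨
  u ℚ.+ Φsum (suc j) l ℚ.+ ι (2 ^ e) ℚ.* powℚ third (j + suc (length l))  ∎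
  where
  open ≡-Reasoning
  u = ι (2 ^ e′) ℚ.* powℚ third j

third^*3^ : ∀ k → powℚ third k ℚ.* ι (3 ^ k) ≡ 1ℚ
third^*3^ zero    = refl
third^*3^ (suc k) = begin
  third ℚ.* powℚ third k ℚ.* ι (3 * 3 ^ k)          ≡⟨ cong (third ℚ.* powℚ third k ℚ.*_) (ι-* 3 (3 ^ k)) ⟩
  third ℚ.* powℚ third k ℚ.* (ι 3 ℚ.* ι (3 ^ k))    ≡⟨ interchange third (powℚ third k) (ι 3) (ι (3 ^ k)) ⟩
  (third ℚ.* ι 3) ℚ.* (powℚ third k ℚ.* ι (3 ^ k))  ≡⟨ cong ((third ℚ.* ι 3) ℚ.*_) (third^*3^ k) ⟩
  (third ℚ.* ι 3) ℚ.* 1ℚ                            ≡⟨ refl ⟩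
  1ℚ                                                ∎
  where
  open ≡-Reasoning
  open +-*-Solver
  interchange : ∀ a b c d → a ℚ.* b ℚ.* (c ℚ.* d) ≡ (a ℚ.* c) ℚ.* (b ℚ.* d)
  interchange = solve 4 (λ a b c d → a :* b :* (c :* d) := (a :* c) :* (b :* d)) refl

Φsum-positions : ∀ n x → Φsum 0 (positions x n) ℚ.* ι (3 ^ ones n x) ≡ ι (Φnumerator n x)
Φsum-positions zero    x = refl
Φsum-positions (suc n) x with x n
... | false = begin
  Φsum 0 (positions x n ++ []) ℚ.* ι (3 ^ (ones n x + 0))
                                          ≡⟨ cong₂ (λ l k → Φsum 0 l ℚ.* ι (3 ^ k)) (List.++-identityʳ (positions x n)) (ℕ.+-identityʳ (ones n x)) ⟩
  Φsum 0 (positions x n) ℚ.* ι (3 ^ ones n x)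
                                          ≡⟨ Φsum-positions n x ⟩
  ι (Φnumerator n x)                      ≡⟨ cong ι (unit (Φnumerator n x)) ⟩
  ι (1 * (Φnumerator n x + 0 * 2 ^ n))   ∎
  where
  open ≡-Reasoning
  unit : ∀ p → p ≡ 1 * (p + 0)
  unit = solve-∀
... | true = begin
  Φsum 0 (l ++ [ n ]) ℚ.* ι (3 ^ (k + 1))
                                          ≡⟨ cong₂ (λ u v → u ℚ.* ι v) (Φsum-snoc 0 l n) (ℕ.^-distribˡ-+-* 3 k 1) ⟩
  (V ℚ.+ ι (2 ^ n) ℚ.* powℚ third (length l)) ℚ.* ι (3 ^ k * 3)
                                          ≡⟨ cong₂ (λ j v → (V ℚ.+ ι (2 ^ n) ℚ.* powℚ third j) ℚ.* v) (length-positions n x) (ι-* (3 ^ k) 3) ⟩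
  (V ℚ.+ ι (2 ^ n) ℚ.* t) ℚ.* (ι (3 ^ k) ℚ.* ι 3)
                                          ≡⟨ expand V (ι (2 ^ n)) t (ι (3 ^ k)) (ι 3) ⟩
  (V ℚ.* ι (3 ^ k) ℚ.+ ι (2 ^ n) ℚ.* (t ℚ.* ι (3 ^ k))) ℚ.* ι 3
                                          ≡⟨ cong₂ (λ u v → (u ℚ.+ ι (2 ^ n) ℚ.* v) ℚ.* ι 3) (Φsum-positions n x) (third^*3^ k) ⟩
  (ι P ℚ.+ ι (2 ^ n) ℚ.* 1ℚ) ℚ.* ι 3      ≡⟨ cong (λ u → (ι P ℚ.+ u) ℚ.* ι 3) (ℚ.*-identityʳ (ι (2 ^ n))) ⟩
  (ι P ℚ.+ ι (2 ^ n)) ℚ.* ι 3             ≡⟨ cong (ℚ._* ι 3) (ι-+ P (2 ^ n)) ⟨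
  ι (P + 2 ^ n) ℚ.* ι 3                   ≡⟨ ι-* (P + 2 ^ n) 3 ⟨
  ι ((P + 2 ^ n) * 3)                     ≡⟨ cong ι (regroup P (2 ^ n)) ⟩
  ι (3 * (P + 1 * 2 ^ n))                 ∎
  where
  open ≡-Reasoning
  open +-*-Solver
  l = positions x n
  k = ones n x
  V = Φsum 0 l
  P = Φnumerator n x
  t = powℚ third k
  expand : ∀ V p t a c → (V ℚ.+ p ℚ.* t) ℚ.* (a ℚ.* c) ≡ (V ℚ.* a ℚ.+ p ℚ.* (t ℚ.* a)) ℚ.* c
  expand = solve 5 (λ V p t a c → (V :+ p :* t) :* (a :* c) := (V :* a :+ p :* (t :* a)) :* c) refl
  regroup : ∀ p q → (p + q) * 3 ≡ 3 * (p + 1 * q)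
  regroup = solve-∀

Φ-L-numerator : ∀ n x → Φ (L n x) ℚ.* ι (3 ^ ones n x) ≡ ℚ.- ι (Φnumerator n x)
Φ-L-numerator n x = begin
  ℚ.- Φsum 0 (exponents (L n x)) ℚ.* ι (3 ^ ones n x)     ≡⟨ cong (λ l → ℚ.- Φsum 0 l ℚ.* ι (3 ^ ones n x)) (exponents-L n x) ⟩
  ℚ.- Φsum 0 (positions x n) ℚ.* ι (3 ^ ones n x)         ≡⟨ ℚ.neg-distribˡ-* (Φsum 0 (positions x n)) (ι (3 ^ ones n x)) ⟨
  ℚ.- (Φsum 0 (positions x n) ℚ.* ι (3 ^ ones n x))       ≡⟨ cong ℚ.-_ (Φsum-positions n x) ⟩
  ℚ.- ι (Φnumerator n x)                                  ∎
  where open ≡-Reasoning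

cross-multiply : ∀ y c a → y ℚ.* ι c ≡ ℚ.- ι a → ↥ y ℤ.* + c ≡ ℤ.- + a ℤ.* ↧ y
cross-multiply y@(mkℚ n d _) c a y*c≡-a = begin
  n ℤ.* + c                             ≡⟨ ℤ.*-identityʳ (n ℤ.* + c) ⟨
  n ℤ.* + c ℤ.* 1ℤ                      ≡⟨ ℚᵘ.drop-*≡* unnormalised ⟩
  ℤ.- + a ℤ.* + suc (d * 1)             ≡⟨ cong (λ m → ℤ.- + a ℤ.* + suc m) (ℕ.*-identityʳ d) ⟩
  ℤ.- + a ℤ.* + suc d                   ∎
  where
  open ≡-Reasoning
  unnormalised : mkℚᵘ n d ℚᵘ.* mkℚᵘ (+ c) 0 ℚᵘ.≃ mkℚᵘ (ℤ.- + a) 0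
  unnormalised = begin-≃
    mkℚᵘ n d ℚᵘ.* mkℚᵘ (+ c) 0          ≈⟨ ℚᵘ.*-cong ℚᵘ.≃-refl (toℚᵘ-ι c) ⟨
    toℚᵘ y ℚᵘ.* toℚᵘ (ι c)              ≈⟨ ℚ.toℚᵘ-homo-* y (ι c) ⟨
    toℚᵘ (y ℚ.* ι c)                    ≈⟨ ℚ.toℚᵘ-cong y*c≡-a ⟩
    toℚᵘ (ℚ.- ι a)                      ≈⟨ ℚ.toℚᵘ-homo‿- (ι a) ⟩
    ℚᵘ.- toℚᵘ (ι a)                     ≈⟨ ℚᵘ.-‿cong (toℚᵘ-ι a) ⟩
    mkℚᵘ (ℤ.- + a) 0                    ∎-≃
    where open ℚᵘ.≃-Reasoning renaming (begin_ to begin-≃_; _∎ to _∎-≃)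

denominator-odd : ∀ y c a → y ℚ.* ι c ≡ ℚ.- ι a → Odd (+ c) → Odd (↧ y)
denominator-odd y@(mkℚ n _ coprime) c a y*c≡-a odd-c =
  odd-divisor (Coprime.coprime-divisor (Coprime.sym (Coprime.recompute coprime)) ↧∣∣↥∣c) odd-c
  where
  ↧∣∣↥∣c : ↧ₙ y ℕ∣.∣ ∣ n ∣ * c
  ↧∣∣↥∣c = ℕ∣.divides a (begin
    ∣ n ∣ * c                  ≡⟨ ℤ.abs-* n (+ c) ⟨
    ∣ n ℤ.* + c ∣              ≡⟨ cong ∣_∣ (cross-multiply y c a y*c≡-a) ⟩
    ∣ ℤ.- + a ℤ.* ↧ y ∣        ≡⟨ ℤ.abs-* (ℤ.- + a) (↧ y) ⟩
    ∣ ℤ.- + a ∣ * ↧ₙ y         ≡⟨ cong (_* ↧ₙ y) (ℤ.∣-i∣≡∣i∣ (+ a)) ⟩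
    a * ↧ₙ y                   ∎)
    where open ≡-Reasoning

Φ-L-expansion : ∀ n x → Expansion (ℤ.- + Φnumerator n x) (+ (3 ^ ones n x)) (ℚtoℤ₂ (Φ (L n x)))
Φ-L-expansion n x = expansion-cancel {↧ y} {ℤ.- + Φnumerator n x} {+ (3 ^ k)} odd-↧
  (subst₂ (λ u v → Expansion u v (ℚtoℤ₂ y)) numerators denominators
    (expansion-scale (+ (3 ^ k)) {↥ y} {↧ y} (ratDigits-expansion odd-↧ (↥ y))))
  where
  y = Φ (L n x)
  k = ones n x
  odd-↧ : Odd (↧ y)
  odd-↧ = denominator-odd y (3 ^ k) (Φnumerator n x) (Φ-L-numerator n x) (odd-3^ k)
  numerators : + (3 ^ k) ℤ.* ↥ y ≡ ↧ y ℤ.* ℤ.- + Φnumerator n x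
  numerators = trans (ℤ.*-comm (+ (3 ^ k)) (↥ y))
    (trans (cross-multiply y (3 ^ k) (Φnumerator n x) (Φ-L-numerator n x)) (ℤ.*-comm (ℤ.- + Φnumerator n x) (↧ y)))
  denominators : + (3 ^ k) ℤ.* ↧ y ≡ ↧ y ℤ.* + (3 ^ k)
  denominators = ℤ.*-comm (+ (3 ^ k)) (↧ y)

-- Truncations of an eventually periodic sequence

module PeriodicTail (d : ℤ₂) (N₀ p′ : ℕ) (periodic : PeriodicFrom N₀ (suc p′) d) where

  p : ℕ
  p = suc p′

  c : ℕ
  c = ones p (R N₀ d)

  Q : ℕ → ℕ
  Q n = Φnumerator p (R n d)

  D : ℤ
  D = + (3 ^ c) ℤ.- + (2 ^ p)

  -- Φ (L n d) = E n / B n + 2 ^ n · Q n / B n (Φ-L-split),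
  -- and E-from shows that E n / B n does not depend on n.
  E : ℕ → ℤ
  E n = ℤ.- (+ Φnumerator n d ℤ.* D ℤ.+ + (2 ^ n) ℤ.* + Q n)

  window-last : ∀ {n} → N₀ ≤ n → R (suc n) d p′ ≡ d n
  window-last {n} N₀≤n = begin
    R (suc n) d p′       ≡⟨ R-apply (suc n) d p′ ⟩
    d (suc n + p′)       ≡⟨ cong d (ℕ.+-suc n p′) ⟨
    d (n + p)            ≡⟨ periodic n N₀≤n ⟩
    d n                  ∎
    where open ≡-Reasoning

  ones-σ-R : ∀ m n → ones m (σ (R n d)) ≡ ones m (R (suc n) d)
  ones-σ-R m n = ones-cong m λ i _ → σ-R n d i

  ones-window-step : ∀ {n} → N₀ ≤ n → ones p (R (suc n) d) ≡ ones p (R n d)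
  ones-window-step {n} N₀≤n = begin
    ones p′ (R (suc n) d) + bitVal (R (suc n) d p′)   ≡⟨ cong (λ b → ones p′ (R (suc n) d) + bitVal b) (window-last N₀≤n) ⟩
    ones p′ (R (suc n) d) + bitVal (d n)              ≡⟨ ℕ.+-comm (ones p′ (R (suc n) d)) (bitVal (d n)) ⟩
    bitVal (d n) + ones p′ (R (suc n) d)              ≡⟨ cong₂ _+_ (cong bitVal (head-R n d)) (ones-σ-R p′ n) ⟨
    bitVal (R n d 0) + ones p′ (σ (R n d))            ≡⟨ ones-+ 1 p′ (R n d) ⟨
    ones p (R n d)                                    ∎
    where open ≡-Reasoning

  ones-window : ∀ {n} → N₀ ≤ n → ones p (R n d) ≡ c
  ones-window N₀≤n with m , refl ← ℕ.m≤n⇒∃[o]m+o≡n N₀≤n = from m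
    where
    from : ∀ m → ones p (R (N₀ + m) d) ≡ c
    from zero    = cong (λ k → ones p (R k d)) (ℕ.+-identityʳ N₀)
    from (suc m) = begin
      ones p (R (N₀ + suc m) d)     ≡⟨ cong (λ k → ones p (R k d)) (ℕ.+-suc N₀ m) ⟩
      ones p (R (suc (N₀ + m)) d)   ≡⟨ ones-window-step (ℕ.m≤m+n N₀ m) ⟩
      ones p (R (N₀ + m) d)         ≡⟨ from m ⟩
      c                             ∎
      where open ≡-Reasoning

  ones-periods : ∀ t {n} → N₀ ≤ n → ones (t * p) (R n d) ≡ t * c
  ones-periods zero    N₀≤n = refl
  ones-periods (suc t) {n} N₀≤n = begin
    ones (p + t * p) (R n d)                       ≡⟨ ones-+ p (t * p) (R n d) ⟩
    ones p (R n d) + ones (t * p) (R p (R n d))    ≡⟨ cong (λ y → ones p (R n d) + ones (t * p) y) (R-+ n p d) ⟨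
    ones p (R n d) + ones (t * p) (R (n + p) d)    ≡⟨ cong₂ _+_ (ones-window N₀≤n) (ones-periods t (ℕ.≤-trans N₀≤n (ℕ.m≤m+n n p))) ⟩
    c + t * c                                      ∎
    where open ≡-Reasoning

  Q-periodic : ∀ t {n} → N₀ ≤ n → Q (n + t * p) ≡ Q n
  Q-periodic t N₀≤n = Φnumerator-cong p λ i _ → R-periodic periodic t N₀≤n i

  Q-step : ∀ {n} → N₀ ≤ n → let b = bitVal (d n) in
    3 ^ b * Q n + 2 ^ p * (b * 3 ^ b) ≡ b * 3 ^ b * 3 ^ c + 2 * Q (suc n)
  Q-step {n} N₀≤n = begin
    3 ^ b * Q n + 2 ^ p * (b * 3 ^ b)
      ≡⟨ cong (λ P → 3 ^ b * P + 2 ^ p * (b * 3 ^ b)) (Φnumerator-+ 1 p′ (R n d)) ⟩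
    3 ^ b * (3 ^ ones p′ (σ (R n d)) * Φnumerator 1 (R n d) + 2 * Φnumerator p′ (σ (R n d))) + 2 ^ p * (b * 3 ^ b)
      ≡⟨ cong₂ (λ k W → 3 ^ b * (3 ^ k * (3 ^ b′ * (0 + b′ * 1)) + 2 * W) + 2 ^ p * (b * 3 ^ b))
               (ones-σ-R p′ n) (Φnumerator-cong p′ λ i _ → σ-R n d i) ⟩
    3 ^ b * (3 ^ K * (3 ^ b′ * (0 + b′ * 1)) + 2 * W) + 2 ^ p * (b * 3 ^ b)
      ≡⟨ cong (λ b″ → 3 ^ b * (3 ^ K * (3 ^ b″ * (0 + b″ * 1)) + 2 * W) + 2 ^ p * (b * 3 ^ b)) (cong bitVal (head-R n d)) ⟩
    3 ^ b * (3 ^ K * (3 ^ b * (0 + b * 1)) + 2 * W) + 2 ^ p * (b * 3 ^ b)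
      ≡⟨ regroup (3 ^ b) (3 ^ K) b W (2 ^ p′) ⟩
    b * 3 ^ b * (3 ^ b * 3 ^ K) + 2 * (3 ^ b * (W + b * 2 ^ p′))
      ≡⟨ cong₂ (λ u v → b * 3 ^ b * u + 2 * (3 ^ bitVal v * (W + bitVal v * 2 ^ p′))) 3^c (window-last N₀≤n) ⟨
    b * 3 ^ b * 3 ^ c + 2 * Q (suc n)
      ∎
    where
    open ≡-Reasoning
    b  = bitVal (d n)
    b′ = bitVal (R n d 0)
    K  = ones p′ (R (suc n) d)
    W  = Φnumerator p′ (R (suc n) d)
    3^c : 3 ^ c ≡ 3 ^ b * 3 ^ K
    3^c = begin
      3 ^ c                 ≡⟨ cong (3 ^_) (ones-window N₀≤n) ⟨
      3 ^ ones p (R n d)    ≡⟨ cong (3 ^_) (ones-window-step N₀≤n) ⟨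
      3 ^ (K + bitVal (R (suc n) d p′))  ≡⟨ cong (λ v → 3 ^ (K + bitVal v)) (window-last N₀≤n) ⟩
      3 ^ (K + b)           ≡⟨ cong (3 ^_) (ℕ.+-comm K b) ⟩
      3 ^ (b + K)           ≡⟨ ℕ.^-distribˡ-+-* 3 b K ⟩
      3 ^ b * 3 ^ K         ∎
    regroup : ∀ T S b W e → T * (S * (T * (0 + b * 1)) + 2 * W) + 2 * e * (b * T) ≡ b * T * (T * S) + 2 * (T * (W + b * e))
    regroup = solve-∀

  2Q-suc : ∀ {n} → N₀ ≤ n → let T = + (3 ^ bitVal (d n)); b = + bitVal (d n) in
    + 2 ℤ.* + Q (suc n) ≡ T ℤ.* + Q n ℤ.+ + (2 ^ p) ℤ.* (b ℤ.* T) ℤ.- b ℤ.* T ℤ.* + (3 ^ c)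
  2Q-suc {n} N₀≤n = begin
    + 2 ℤ.* + Q (suc n)                        ≡⟨ cancel (b ℤ.* T ℤ.* + (3 ^ c)) (+ 2 ℤ.* + Q (suc n)) ⟩
    b ℤ.* T ℤ.* + (3 ^ c) ℤ.+ + 2 ℤ.* + Q (suc n) ℤ.- b ℤ.* T ℤ.* + (3 ^ c)
                                               ≡⟨ cong (ℤ._- b ℤ.* T ℤ.* + (3 ^ c)) Q-stepℤ ⟨
    T ℤ.* + Q n ℤ.+ + (2 ^ p) ℤ.* (b ℤ.* T) ℤ.- b ℤ.* T ℤ.* + (3 ^ c)
                                               ∎
    where
    open ≡-Reasoning
    T = + (3 ^ bitVal (d n))
    b = + bitVal (d n)
    cancel : ∀ w z → z ≡ w ℤ.+ z ℤ.- w
    cancel = ℤ.solve-∀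
    Q-stepℤ : T ℤ.* + Q n ℤ.+ + (2 ^ p) ℤ.* (b ℤ.* T) ≡ b ℤ.* T ℤ.* + (3 ^ c) ℤ.+ + 2 ℤ.* + Q (suc n)
    Q-stepℤ = begin
      T ℤ.* + Q n ℤ.+ + (2 ^ p) ℤ.* (b ℤ.* T)
        ≡⟨ cong₂ ℤ._+_ (ℤ.pos-* (3 ^ bitVal (d n)) (Q n))
                       (trans (ℤ.pos-* (2 ^ p) _) (cong (ℤ._*_ (+ (2 ^ p))) (ℤ.pos-* (bitVal (d n)) _))) ⟨
      + (3 ^ bitVal (d n) * Q n) ℤ.+ + (2 ^ p * (bitVal (d n) * 3 ^ bitVal (d n)))
        ≡⟨ ℤ.pos-+ (3 ^ bitVal (d n) * Q n) _ ⟨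
      + (3 ^ bitVal (d n) * Q n + 2 ^ p * (bitVal (d n) * 3 ^ bitVal (d n)))
        ≡⟨ cong +_ (Q-step N₀≤n) ⟩
      + (bitVal (d n) * 3 ^ bitVal (d n) * 3 ^ c + 2 * Q (suc n))
        ≡⟨ ℤ.pos-+ (bitVal (d n) * 3 ^ bitVal (d n) * 3 ^ c) _ ⟩
      + (bitVal (d n) * 3 ^ bitVal (d n) * 3 ^ c) ℤ.+ + (2 * Q (suc n))
        ≡⟨ cong₂ ℤ._+_ (trans (ℤ.pos-* (bitVal (d n) * 3 ^ bitVal (d n)) (3 ^ c))
                              (cong (ℤ._* + (3 ^ c)) (ℤ.pos-* (bitVal (d n)) _)))
                       (ℤ.pos-* 2 (Q (suc n))) ⟩
      b ℤ.* T ℤ.* + (3 ^ c) ℤ.+ + 2 ℤ.* + Q (suc n)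
        ∎

  E-step : ∀ {n} → N₀ ≤ n → E (suc n) ≡ + (3 ^ bitVal (d n)) ℤ.* E n
  E-step {n} N₀≤n = begin
    ℤ.- (+ Φnumerator (suc n) d ℤ.* D ℤ.+ + (2 ^ suc n) ℤ.* Qs)
      ≡⟨ cong₂ (λ P e′ → ℤ.- (P ℤ.* D ℤ.+ e′ ℤ.* Qs)) P-suc (ℤ.pos-* 2 (2 ^ n)) ⟩
    ℤ.- (T ℤ.* (Pn ℤ.+ bb ℤ.* e) ℤ.* D ℤ.+ + 2 ℤ.* e ℤ.* Qs)
      ≡⟨ regroup T (Pn ℤ.+ bb ℤ.* e) D e Qs ⟩
    ℤ.- (T ℤ.* (Pn ℤ.+ bb ℤ.* e) ℤ.* D ℤ.+ e ℤ.* (+ 2 ℤ.* Qs))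
      ≡⟨ cong (λ u → ℤ.- (T ℤ.* (Pn ℤ.+ bb ℤ.* e) ℤ.* D ℤ.+ e ℤ.* u)) (2Q-suc N₀≤n) ⟩
    ℤ.- (T ℤ.* (Pn ℤ.+ bb ℤ.* e) ℤ.* D ℤ.+ e ℤ.* (T ℤ.* Qn ℤ.+ P2 ℤ.* (bb ℤ.* T) ℤ.- bb ℤ.* T ℤ.* C3))
      ≡⟨ telescope T Pn bb e C3 P2 Qn ⟩
    T ℤ.* E n
      ∎
    where
    open ≡-Reasoning
    b  = bitVal (d n)
    T  = + (3 ^ b)
    bb = + b
    e  = + (2 ^ n)
    C3 = + (3 ^ c)
    P2 = + (2 ^ p)
    Pn = + Φnumerator n d
    Qn = + Q n
    Qs = + Q (suc n)
    P-suc : + Φnumerator (suc n) d ≡ T ℤ.* (Pn ℤ.+ bb ℤ.* e)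
    P-suc = trans (ℤ.pos-* (3 ^ b) _)
      (cong (ℤ._*_ T) (trans (ℤ.pos-+ (Φnumerator n d) _) (cong (ℤ._+_ Pn) (ℤ.pos-* b (2 ^ n)))))
    regroup : ∀ T A D e Q → ℤ.- (T ℤ.* A ℤ.* D ℤ.+ + 2 ℤ.* e ℤ.* Q) ≡ ℤ.- (T ℤ.* A ℤ.* D ℤ.+ e ℤ.* (+ 2 ℤ.* Q))
    regroup = ℤ.solve-∀
    telescope : ∀ T Pn bb e C3 P2 Qn →
      ℤ.- (T ℤ.* (Pn ℤ.+ bb ℤ.* e) ℤ.* (C3 ℤ.- P2) ℤ.+ e ℤ.* (T ℤ.* Qn ℤ.+ P2 ℤ.* (bb ℤ.* T) ℤ.- bb ℤ.* T ℤ.* C3))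
        ≡ T ℤ.* ℤ.- (Pn ℤ.* (C3 ℤ.- P2) ℤ.+ e ℤ.* Qn)
    telescope = ℤ.solve-∀

  E-from : ∀ m → E (N₀ + m) ≡ + (3 ^ ones m (R N₀ d)) ℤ.* E N₀
  E-from zero    = trans (cong E (ℕ.+-identityʳ N₀)) (sym (ℤ.*-identityˡ (E N₀)))
  E-from (suc m) = begin
    E (N₀ + suc m)                        ≡⟨ cong E (ℕ.+-suc N₀ m) ⟩
    E (suc (N₀ + m))                      ≡⟨ E-step (ℕ.m≤m+n N₀ m) ⟩
    + (3 ^ b) ℤ.* E (N₀ + m)              ≡⟨ cong (ℤ._*_ (+ (3 ^ b))) (E-from m) ⟩
    + (3 ^ b) ℤ.* (+ (3 ^ κ) ℤ.* E N₀)    ≡⟨ ℤ.*-assoc (+ (3 ^ b)) (+ (3 ^ κ)) (E N₀) ⟨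
    + (3 ^ b) ℤ.* + (3 ^ κ) ℤ.* E N₀      ≡⟨ cong (ℤ._* E N₀) 3^κ+b ⟩
    + (3 ^ ones (suc m) (R N₀ d)) ℤ.* E N₀ ∎
    where
    open ≡-Reasoning
    b = bitVal (d (N₀ + m))
    κ = ones m (R N₀ d)
    3^κ+b : + (3 ^ b) ℤ.* + (3 ^ κ) ≡ + (3 ^ (κ + bitVal (R N₀ d m)))
    3^κ+b = begin
      + (3 ^ b) ℤ.* + (3 ^ κ)             ≡⟨ ℤ.pos-* (3 ^ b) (3 ^ κ) ⟨
      + (3 ^ b * 3 ^ κ)                   ≡⟨ cong +_ (ℕ.^-distribˡ-+-* 3 b κ) ⟨
      + (3 ^ (b + κ))                     ≡⟨ cong (λ k → + (3 ^ k)) (ℕ.+-comm b κ) ⟩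
      + (3 ^ (κ + b))                     ≡⟨ cong (λ v → + (3 ^ (κ + bitVal v))) (R-apply N₀ d m) ⟨
      + (3 ^ (κ + bitVal (R N₀ d m)))     ∎

  odd-D : Odd D
  odd-D = +-cong-mod (odd-3^ c) (-‿cong-mod 2^p≡0)
    where
    2^p≡0 : + (2 ^ p) ≡ 0ℤ [mod2^ 1 ]
    2^p≡0 = subst (_≡ 0ℤ [mod2^ 1 ]) (sym (ℤ.pos-* 2 (2 ^ p′))) (2^n*e≡0 1 (+ (2 ^ p′)))

  B : ℕ → ℤ
  B n = + (3 ^ ones n d) ℤ.* D

  odd-B : ∀ n → Odd (B n)
  odd-B n = odd-* (odd-3^ (ones n d)) odd-D

  Z : ℤ₂
  Z = fractionDigits (E N₀) (B N₀)

  τ : ℕ → ℤ₂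
  τ n = fractionDigits (+ Q n) (B n)

  τ-expansion : ∀ n → Expansion (+ Q n) (B n) (τ n)
  τ-expansion n = fractionDigits-expansion (odd-B n) (+ Q n)

  Φ-L-split : ∀ {n} → N₀ ≤ n → ∀ H →
    + L H (R n (ℚtoℤ₂ (Φ (L n d)))) ≡ + L H (R n Z) ℤ.+ + L H (τ n) [mod2^ H ]
  Φ-L-split N₀≤n H with m , refl ← ℕ.m≤n⇒∃[o]m+o≡n N₀≤n =
    expansion-shift-+ n H (odd-B n) Φ-expansion Z-expansion (τ-expansion n)
    where
    n = N₀ + m
    Φ-expansion : Expansion (E n ℤ.+ + (2 ^ n) ℤ.* + Q n) (B n) (ℚtoℤ₂ (Φ (L n d)))
    Φ-expansion = subst₂ (λ u v → Expansion u v (ℚtoℤ₂ (Φ (L n d))))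
      (split-off (+ Φnumerator n d) D (+ (2 ^ n)) (+ Q n)) (ℤ.*-comm D (+ (3 ^ ones n d)))
      (expansion-scale D (Φ-L-expansion n d))
      where
      split-off : ∀ P D e Q → D ℤ.* ℤ.- P ≡ ℤ.- (P ℤ.* D ℤ.+ e ℤ.* Q) ℤ.+ e ℤ.* Q
      split-off = ℤ.solve-∀
    Z-expansion : Expansion (E n) (B n) Z
    Z-expansion = subst₂ (λ u v → Expansion u v Z) (sym (E-from m)) B-from
      (expansion-scale (+ (3 ^ κ)) (fractionDigits-expansion (odd-B N₀) (E N₀)))
      where
      κ = ones m (R N₀ d)
      B-from : + (3 ^ κ) ℤ.* B N₀ ≡ B n
      B-from = begin
        + (3 ^ κ) ℤ.* (+ (3 ^ ones N₀ d) ℤ.* D)     ≡⟨ ℤ.*-assoc (+ (3 ^ κ)) _ D ⟨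
        + (3 ^ κ) ℤ.* + (3 ^ ones N₀ d) ℤ.* D       ≡⟨ cong (ℤ._* D) (ℤ.pos-* (3 ^ κ) _) ⟨
        + (3 ^ κ * 3 ^ ones N₀ d) ℤ.* D             ≡⟨ cong (λ u → + u ℤ.* D) (ℕ.*-comm (3 ^ κ) _) ⟩
        + (3 ^ ones N₀ d * 3 ^ κ) ℤ.* D             ≡⟨ cong (λ u → + u ℤ.* D) (ℕ.^-distribˡ-+-* 3 (ones N₀ d) κ) ⟨
        + (3 ^ (ones N₀ d + κ)) ℤ.* D               ≡⟨ cong (λ k → + (3 ^ k) ℤ.* D) (ones-+ N₀ m d) ⟨
        B n                                         ∎
        where open ≡-Reasoning

  τ-periodic : ∀ H s {n} → N₀ ≤ n → L H (τ (n + 2 ^ H * s * p)) ≡ L H (τ n)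
  τ-periodic H s {n} N₀≤n = expansion-L-unique H (odd-B n′) (τ-expansion n′) (τ-expansion n)
    (mod-reflexive (cong +_ (Q-periodic (2 ^ H * s) N₀≤n))) (*-cong-mod 3^k′≡3^k (mod-reflexive {a = D} refl))
    where
    n′ = n + 2 ^ H * s * p
    3^k′≡3^k : + (3 ^ ones n′ d) ≡ + (3 ^ ones n d) [mod2^ H ]
    3^k′≡3^k = begin
      + (3 ^ ones n′ d)                                 ≡⟨ cong (λ k → + (3 ^ k)) (ones-+ n (2 ^ H * s * p) d) ⟩
      + (3 ^ (ones n d + ones (2 ^ H * s * p) (R n d)))  ≡⟨ cong (λ k → + (3 ^ (ones n d + k))) (ones-periods (2 ^ H * s) N₀≤n) ⟩
      + (3 ^ (ones n d + 2 ^ H * s * c))                ≡⟨ cong (λ k → + (3 ^ (ones n d + k))) (ℕ.*-assoc (2 ^ H) s c) ⟩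
      + (3 ^ (ones n d + 2 ^ H * (s * c)))              ≈⟨ 3^-periodic H (ones n d) (s * c) ⟩
      + (3 ^ ones n d)                                  ∎
      where open ≡-mod-Reasoning H

  Φ-L-periodic : ∀ H {N₁ p₁} → PeriodicFrom N₁ p₁ Z → ∀ {n} → N₀ + N₁ ≤ n →
    L H (R (n + 2 ^ H * p₁ * p) (ℚtoℤ₂ (Φ (L (n + 2 ^ H * p₁ * p) d)))) ≡ L H (R n (ℚtoℤ₂ (Φ (L n d))))
  Φ-L-periodic H {N₁} {p₁} Z-periodic {n} N₀+N₁≤n = residue-unique (L<2^ H _) (L<2^ H _) (begin
    + L H (R n′ (ℚtoℤ₂ (Φ (L n′ d))))        ≈⟨ Φ-L-split (ℕ.≤-trans N₀≤n (ℕ.m≤m+n n T)) H ⟩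
    + L H (R n′ Z) ℤ.+ + L H (τ n′)          ≡⟨ cong₂ (λ u v → + u ℤ.+ + v) Z-part (τ-periodic H p₁ N₀≤n) ⟩
    + L H (R n Z) ℤ.+ + L H (τ n)            ≈⟨ Φ-L-split N₀≤n H ⟨
    + L H (R n (ℚtoℤ₂ (Φ (L n d))))          ∎)
    where
    open ≡-mod-Reasoning H
    T  = 2 ^ H * p₁ * p
    n′ = n + T
    N₀≤n : N₀ ≤ n
    N₀≤n = ℕ.≤-trans (ℕ.m≤m+n N₀ N₁) N₀+N₁≤n
    Z-part : L H (R n′ Z) ≡ L H (R n Z)
    Z-part = trans (cong (λ t → L H (R (n + t) Z)) (swap (2 ^ H) p₁ p))
                   (L-R-periodic Z-periodic H (2 ^ H * p) (ℕ.≤-trans (ℕ.m≤n+m N₁ N₀) N₀+N₁≤n))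
      where
      swap : ∀ a b c → a * b * c ≡ a * c * b
      swap = solve-∀

theorem6 : (H : ℕ) → 3 ≤ H → (q : ℚ) → InZ₂ q →
    EventuallyPeriodic (λ n → L H (R n (ℚtoℤ₂ (Φ (L n (ℚtoℤ₂ q))))))
theorem6 H _ q q∈ℤ₂ = from-digits (ratDigits-eventuallyPeriodic (odd-%2 q∈ℤ₂) (↥ q))
  where
  sequence : ℕ → ℕ
  sequence n = L H (R n (ℚtoℤ₂ (Φ (L n (ℚtoℤ₂ q)))))
  from-digits : EventuallyPeriodicDigits (ℚtoℤ₂ q) → EventuallyPeriodic sequence
  from-digits (N₀ , suc p′ , _ , periodic) = from-Z (fractionDigits-eventuallyPeriodic (odd-B N₀) (E N₀))
    where
    open PeriodicTail (ℚtoℤ₂ q) N₀ p′ periodic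
    from-Z : EventuallyPeriodicDigits Z → EventuallyPeriodic sequence
    from-Z (N₁ , p₁ , 0<p₁ , Z-periodic) =
      N₀ + N₁ , 2 ^ H * p₁ * p , ℕ.*-mono-< (ℕ.*-mono-< (ℕ.m^n>0 2 H) 0<p₁) (s≤s z≤n) ,
      λ n N₀+N₁≤n → Φ-L-periodic H Z-periodic N₀+N₁≤n
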